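{- Let $S=(V,L)$ be a $3$-connected isotropic system and let $v_0v_1\dots v_{k+1}$ be a tight path of length $k\ge3$ in $H(S)$. If $\{v_k,v_{k+1},v_0\}$ is an edge of $H(S)$, then $S$ has a fundamental graph that is a cycle of length $k+2$.
   Context: $K=\{0,\alpha,\beta,\gamma\}$ is the $2$-dimensional $\mathrm{GF}(2)$-space with bilinear form $\langle x,y\rangle=1$ iff $0\ne x\ne y\ne0$; $K^V$ is the space of functions $V\to K$ with $\langle\mathbf a,\mathbf b\rangle=\sum_v\langle\mathbf a(v),\mathbf b(v)\rangle$; $\mathrm{supp}(\mathbf a)=\{v:\mathbf a(v)\ne0\}$, $\mathbf a$ complete if $\mathrm{supp}(\mathbf a)=V$; $p_X$ is restriction to $X$, $\mathbf a[X]$ agrees with $\mathbf a$ on $X$ and is $0$ off $X$. An isotropic system $S=(V,L)$ is a finite set $V$ with a subspace $L\subseteq K^V$ such that $\langle\mathbf a,\mathbf b\rangle=0$ for all $\mathbf a,\mathbf b\in L$ and $\dim L=|V|$. Connectivity: $c_S(X)=|X|-\dim\{p_X(\mathbf a):\mathbf a\in L,\mathrm{supp}(\mathbf a)\subseteq X\}$; $(X,Y)$ is a $k$-separation if $\min\{|X|,|Y|\}\ge k$ and $c_S(X)<k$; $S$ is $3$-connected if it has no $1$- or $2$-separation. An Eulerian vector is a complete $\mathbf a$ with $\mathbf a[X]\notin L$ for all nonempty $X\subseteq V$; then for each $v$ there is a unique $\mathbf b_v\in L$ with $\langle\mathbf b_v(v),\mathbf a(v)\rangle=1$ and $\langle\mathbf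 b_v(w),\mathbf a(w)\rangle=0$ for $w\ne v$; the fundamental graph of $S$ w.r.t. $\mathbf a$ is the graph on $V$ with $v\sim w$ iff $\mathbf b_v(w)\ne0$. A triangle is a vector of $L$ with support of size $3$; $H(S)$ is the $3$-uniform hypergraph on $V$ whose edges are supports of triangles. A sequence $u_0\dots u_{k+1}$ of distinct vertices is a tight path of length $k$ in $H(S)$ if $\{u_{i-1},u_i,u_{i+1}\}\in E(H(S))$ for $1\le i\le k$. -}

module Defs where

open import Data.Nat using (ℕ; zero; suc; _+_; _∸_; _≤_; _<_; _%_)
open import Data.Bool using (Bool; true; false; _xor_; if_then_else_)
open import Data.Fin using (Fin; toℕ)
open import Data.Fin.Subset using (Subset; _∈_; ∣_∣; ∁; Nonempty)
open import Data.Vec using (Vec; []; _∷_; lookup; zipWith; replicate; foldr)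
open import Data.Vec.Relation.Unary.All using (All)
open import Data.Product using (Σ; ∃; _×_; _,_)
open import Data.Sum using (_⊎_)
open import Relation.Nullary using (¬_)
open import Relation.Binary.PropositionalEquality using (_≡_; _≢_)
open import Function.Bundles using (_⇔_)
open import Function.Definitions using (Injective; Surjective)

-- The Klein four-group K = {0, α, β, γ} as a 2-dim GF(2)-space
data K : Set where
  O α β γ : K

_+K_ : K → K → K
O +K y = y
x +K O = x
α +K α = O
α +K β = γ
α +K γ = β
β +K α = γ
β +K β = O
β +K γ = α
γ +K α = β
γ +K β = α
γ +K γ = O

⟨_,_⟩K : K → K → Bool
⟨ O , _ ⟩K = false
⟨ _ , O ⟩K = false
⟨ α , α ⟩K = false
⟨ β , β ⟩K = false
⟨ γ , γ ⟩K = false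
⟨ _ , _ ⟩K = true

module _ {n : ℕ} where

  KV : Set
  KV = Vec K n

  0V : KV
  0V = replicate n O

  _+V_ : KV → KV → KV
  _+V_ = zipWith _+K_

  ⟨_,_⟩ : KV → KV → Bool
  ⟨ a , b ⟩ = foldr (λ _ → Bool) _xor_ false (zipWith ⟨_,_⟩K a b)

  restrict : Subset n → KV → KV
  restrict X a = zipWith (λ b x → if b then x else O) X a

  SuppIn : KV → Subset n → Set
  SuppIn a X = ∀ i → lookup a i ≢ O → i ∈ X

  Complete : KV → Set
  Complete a = ∀ i → lookup a i ≢ O

  combo : ∀ {d} → Vec KV d → Vec Bool d → KV
  combo [] [] = 0V
  combo (b ∷ bs) (c ∷ cs) = (if c then b else 0V) +V combo bs cs

  HasDim : (KV → Set) → ℕ → Set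
  HasDim W d = Σ (Vec KV d) λ bs →
      All W bs
    × (∀ cs → combo bs cs ≡ 0V → cs ≡ replicate d false)
    × (∀ a → W a → ∃ λ cs → combo bs cs ≡ a)

record IsotropicSystem (n : ℕ) : Set₁ where
  field
    L        : Vec K n → Set
    L-zero   : L 0V
    L-add    : ∀ a b → L a → L b → L (a +V b)
    L-isotr  : ∀ a b → L a → L b → ⟨ a , b ⟩ ≡ false
    L-dim    : HasDim L n

module _ {n : ℕ} (S : IsotropicSystem n) where
  open IsotropicSystem S

  -- {a ∈ L : supp a ⊆ X}; p_X maps it isomorphically onto {p_X(a) : a ∈ L, supp a ⊆ X}
  LIn : Subset n → Vec K n → Set
  LIn X a = L a × SuppIn a X

  ConnLt : Subset n → ℕ → Set
  ConnLt X k = ∃ λ d → HasDim (LIn X) d × (∣ X ∣ ∸ d < k)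

  Separation : ℕ → Subset n → Set
  Separation k X = k ≤ ∣ X ∣ × k ≤ ∣ ∁ X ∣ × ConnLt X k

  ThreeConnected : Set
  ThreeConnected = ∀ X → ¬ Separation 1 X × ¬ Separation 2 X

  Eulerian : Vec K n → Set
  Eulerian a = Complete a × (∀ X → Nonempty X → ¬ L (restrict X a))

  IsBv : Vec K n → Fin n → Vec K n → Set
  IsBv a v b = L b × ⟨ lookup b v , lookup a v ⟩K ≡ true
             × (∀ w → w ≢ v → ⟨ lookup b w , lookup a w ⟩K ≡ false)

  -- adjacency in the fundamental graph w.r.t. a (for v ≠ w): b_v(w) ≠ 0
  FundAdj : Vec K n → Fin n → Fin n → Set
  FundAdj a v w = ∃ λ b → IsBv a v b × lookup b w ≢ O

  -- {x,y,z} is an edge of H(S): support of a triangle in L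
  HEdge : Fin n → Fin n → Fin n → Set
  HEdge x y z = x ≢ y × y ≢ z × x ≢ z
    × ∃ λ t → L t × (∀ u → (lookup t u ≢ O) ⇔ (u ≡ x ⊎ u ≡ y ⊎ u ≡ z))

CycAdj : (m : ℕ) → Fin (suc m) → Fin (suc m) → Set
CycAdj m i j = (suc (toℕ i) % suc m ≡ toℕ j) ⊎ (suc (toℕ j) % suc m ≡ toℕ i)

-- the graph G (adjacency on distinct vertices of Fin n) is a cycle of length suc m
IsCycle : {n : ℕ} → (Fin n → Fin n → Set) → ℕ → Set
IsCycle {n} G m = Σ (Fin (suc m) → Fin n) λ f →
    Injective _≡_ _≡_ f × Surjective _≡_ _≡_ f
  × (∀ i j → i ≢ j → G (f i) (f j) ⇔ CycAdj m i j)

module Submission where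

-- Write the cycle as p 0, …, p (k+1), indices modulo k+2, and let T s be the triangle of L
-- on {p s, p (s+1), p (s+2)}; the hypotheses provide all of them except T (k+1).
-- Since 3-connectivity forbids nonzero vectors of L supported on two vertices, isotropy of
-- two consecutive triangles forces them to pair nontrivially at both shared vertices, and
-- triangles two apart agree at their single common vertex.  This yields a complete vector a
-- with T s (s) = a s, T s (s+2) = a (s+2) and ⟨T s (s+1), a (s+1)⟩ = 1.  Adding triangles
-- reduces every vector of L to one orthogonal to a at p 1, …, p (k+1); counting dimensions
-- against X = V ∖ {p 1, …, p (k+1)} and using 3-connectivity once more produces the missing
-- triangle on {p (k+1), p 0, p 1} and shows that p is onto.  Then T (s-1) is the vector b_{p s}
-- of a for every s, so a is Eulerian and its fundamental graph is the cycle.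


open import Defs
open import Algebra.Bundles using (CommutativeRing)
open import Data.Bool using (Bool; true; false; _xor_; _∧_; not; if_then_else_)
open import Data.Bool.Properties
  using (¬-not; ∧-zeroʳ; ∧-identityʳ; xor-same; xor-identityʳ; xor-∧-commutativeRing)
  renaming (_≟_ to _≟B_)
open import Data.Empty using (⊥; ⊥-elim)
open import Data.Fin using (Fin; zero; suc; toℕ; fromℕ; fromℕ<; inject₁; punchIn; combine; remQuot)
open import Data.Fin.Properties
  using (any?; all?; suc-injective; 0≢1+n; toℕ-injective; toℕ<n; toℕ-fromℕ; toℕ-fromℕ<; toℕ-inject₁;
         fromℕ≢inject₁; punchInᵢ≢i; 2↔Bool; remQuot-combine; combine-remQuot; injective⇒≤)
  renaming (_≟_ to _≟F_)
open import Data.Fin.Relation.Unary.Top using (view; ‵fromℕ; ‵inj₁)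
open import Data.Fin.Subset using (Subset; ∣_∣; ∁; ⁅_⁆; _∪_; _-_; inside; outside)
  renaming (_∈_ to _∈ₛ_; _∉_ to _∉ₛ_)
open import Data.Fin.Subset.Properties
  using (_∈?_; x∈p∪q⁺; x∈p∪q⁻; x∈⁅x⁆; x∈⁅y⁆⇒x≡y; x∉p⇒x∈∁p; x∈p⇒∣p-x∣<∣p∣; x∈p∧x≢y⇒x∈p-y;
         ∣⁅x⁆∣≡1; ∣∁p∣≡n∸∣p∣; ∣p∣≤n)
open import Data.List using (List; []; _∷_; cartesianProductWith)
open import Data.List.Membership.Propositional using (_∈_)
open import Data.List.Membership.Propositional.Properties using (∈-cartesianProductWith⁺)
open import Data.List.Relation.Unary.Any using (here; there)
open import Data.Nat using (ℕ; zero; suc; _+_; _*_; _∸_; _≤_; _<_; z≤n; s≤s; _^_; _%_; _/_)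
open import Data.Nat.DivMod
  using (m%n<n; %-distribˡ-+; m%n%n≡m%n; m<n⇒m%n≡m; [m+n]%n≡m%n; m≡m%n+[m/n]*n; n%n≡0)
open import Data.Nat.Properties
  using (≤-trans; ≤-reflexive; n≤1+n; m≤m+n; n≮n; ≮⇒≥; <⇒≱; +-identityʳ; +-suc; +-cancelˡ-≡;
         +-cancelˡ-≤; +-monoˡ-≤; ∸-mono; m∸n+n≡m; m≤n+o⇒m∸n≤o; ^-monoʳ-<; module ≤-Reasoning)
open import Data.Product using (Σ; ∃; _×_; _,_; proj₁; proj₂)
open import Data.Sum using (_⊎_; inj₁; inj₂)
open import Data.Vec using (Vec; []; _∷_; lookup; tail; zipWith; replicate; _++_; tabulate)
open import Data.Vec.Properties
  using (≡-dec; lookup-zipWith; lookup-replicate; lookup∘tabulate; tabulate∘lookup; tabulate-cong;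
         lookup⇒[]=; []=⇒lookup; zipWith-comm; zipWith-assoc; zipWith-identityˡ)
open import Data.Vec.Relation.Unary.All using (All; []; _∷_)
open import Data.Vec.Relation.Unary.All.Properties using (tabulate⁺; lookup⁺)
open import Function.Base using (_∘_; case_of_)
open import Function.Bundles using (Inverse; Equivalence; _⇔_; mk⇔)
open import Function.Definitions using (Injective)
open import Relation.Binary using (DecidableEquality)
open import Relation.Binary.PropositionalEquality
open import Relation.Nullary using (¬_; Dec; yes; no; does; ¬?; _×-dec_; _→-dec_)
open import Relation.Nullary.Decidable using (dec-true; dec-false)
open import Relation.Unary using (Decidable)

open import Algebra.Properties.CommutativeMonoid.Sum
  (CommutativeRing.+-commutativeMonoid xor-∧-commutativeRing)
  using (sum; sum-cong-≗; sum-remove; sum-replicate-zero; ∑-distrib-+)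

-- The Klein four-group

_≟K_ : DecidableEquality K
O ≟K O = yes refl
O ≟K α = no λ ()
O ≟K β = no λ ()
O ≟K γ = no λ ()
α ≟K O = no λ ()
α ≟K α = yes refl
α ≟K β = no λ ()
α ≟K γ = no λ ()
β ≟K O = no λ ()
β ≟K α = no λ ()
β ≟K β = yes refl
β ≟K γ = no λ ()
γ ≟K O = no λ ()
γ ≟K α = no λ ()
γ ≟K β = no λ ()
γ ≟K γ = yes refl

K-elim : (P : K → Set) → P O → P α → P β → P γ → ∀ x → P x
K-elim P pO pα pβ pγ O = pO
K-elim P pO pα pβ pγ α = pα
K-elim P pO pα pβ pγ β = pβ
K-elim P pO pα pβ pγ γ = pγ

+K-identityʳ : ∀ x → x +K O ≡ x
+K-identityʳ = K-elim _ refl refl refl refl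

+K-self : ∀ x → x +K x ≡ O
+K-self = K-elim _ refl refl refl refl

+K-comm : ∀ x y → x +K y ≡ y +K x
+K-comm = K-elim _ (K-elim _ refl refl refl refl) (K-elim _ refl refl refl refl)
                   (K-elim _ refl refl refl refl) (K-elim _ refl refl refl refl)

+K-assoc : ∀ x y z → (x +K y) +K z ≡ x +K (y +K z)
+K-assoc O y z = refl
+K-assoc α = K-elim _ (λ _ → refl) (K-elim _ refl refl refl refl)
                     (K-elim _ refl refl refl refl) (K-elim _ refl refl refl refl)
+K-assoc β = K-elim _ (λ _ → refl) (K-elim _ refl refl refl refl)
                     (K-elim _ refl refl refl refl) (K-elim _ refl refl refl refl)
+K-assoc γ = K-elim _ (λ _ → refl) (K-elim _ refl refl refl refl)
                     (K-elim _ refl refl refl refl) (K-elim _ refl refl refl refl)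

+K-cancel : ∀ x y → x +K y ≡ O → x ≡ y
+K-cancel x y x+y≡O = begin
  x               ≡⟨ sym (+K-identityʳ x) ⟩
  x +K O          ≡⟨ cong (x +K_) (sym (+K-self y)) ⟩
  x +K (y +K y)   ≡⟨ sym (+K-assoc x y y) ⟩
  (x +K y) +K y   ≡⟨ cong (_+K y) x+y≡O ⟩
  y               ∎
  where open ≡-Reasoning

⟨⟩K-zeroʳ : ∀ x → ⟨ x , O ⟩K ≡ false
⟨⟩K-zeroʳ = K-elim _ refl refl refl refl

⟨⟩K-self : ∀ x → ⟨ x , x ⟩K ≡ false
⟨⟩K-self = K-elim _ refl refl refl refl

⟨⟩K-sym : ∀ x y → ⟨ x , y ⟩K ≡ ⟨ y , x ⟩K
⟨⟩K-sym = K-elim _ (K-elim _ refl refl refl refl) (K-elim _ refl refl refl refl)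
                   (K-elim _ refl refl refl refl) (K-elim _ refl refl refl refl)

⟨⟩K-distribʳ-+K : ∀ x y z → ⟨ x +K y , z ⟩K ≡ ⟨ x , z ⟩K xor ⟨ y , z ⟩K
⟨⟩K-distribʳ-+K O y z = refl
⟨⟩K-distribʳ-+K α = K-elim _ (K-elim _ refl refl refl refl) (K-elim _ refl refl refl refl)
                            (K-elim _ refl refl refl refl) (K-elim _ refl refl refl refl)
⟨⟩K-distribʳ-+K β = K-elim _ (K-elim _ refl refl refl refl) (K-elim _ refl refl refl refl)
                            (K-elim _ refl refl refl refl) (K-elim _ refl refl refl refl)
⟨⟩K-distribʳ-+K γ = K-elim _ (K-elim _ refl refl refl refl) (K-elim _ refl refl refl refl)
                            (K-elim _ refl refl refl refl) (K-elim _ refl refl refl refl)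

⟨⟩K≡false⇒O⊎≡ : ∀ x y → y ≢ O → ⟨ x , y ⟩K ≡ false → x ≡ O ⊎ x ≡ y
⟨⟩K≡false⇒O⊎≡ O y y≢O _ = inj₁ refl
⟨⟩K≡false⇒O⊎≡ x O y≢O _ = ⊥-elim (y≢O refl)
⟨⟩K≡false⇒O⊎≡ α α _ _ = inj₂ refl
⟨⟩K≡false⇒O⊎≡ β β _ _ = inj₂ refl
⟨⟩K≡false⇒O⊎≡ γ γ _ _ = inj₂ refl
⟨⟩K≡false⇒O⊎≡ α β _ ()
⟨⟩K≡false⇒O⊎≡ α γ _ ()
⟨⟩K≡false⇒O⊎≡ β α _ ()
⟨⟩K≡false⇒O⊎≡ β γ _ ()
⟨⟩K≡false⇒O⊎≡ γ α _ ()
⟨⟩K≡false⇒O⊎≡ γ β _ ()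

⟨⟩K≡false⇒≡ : ∀ {x y} → x ≢ O → y ≢ O → ⟨ x , y ⟩K ≡ false → x ≡ y
⟨⟩K≡false⇒≡ {x} {y} x≢O y≢O ⟨x,y⟩≡false with ⟨⟩K≡false⇒O⊎≡ x y y≢O ⟨x,y⟩≡false
... | inj₁ x≡O = ⊥-elim (x≢O x≡O)
... | inj₂ x≡y = x≡y

xor-middle : ∀ x y z → x xor (y xor z) ≡ false → x xor z ≡ y
xor-middle true  true  true  ()
xor-middle true  true  false _ = refl
xor-middle true  false true  _ = refl
xor-middle true  false false ()
xor-middle false true  true  _ = refl
xor-middle false true  false ()
xor-middle false false true  ()
xor-middle false false false _ = refl

-- Linear algebra in K^V

+V-self : ∀ {n} (a : KV {n}) → a +V a ≡ 0V
+V-self [] = refl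
+V-self (x ∷ a) = cong₂ _∷_ (+K-self x) (+V-self a)

module _ {n : ℕ} where

  lookup-+V : ∀ (a b : KV {n}) i → lookup (a +V b) i ≡ lookup a i +K lookup b i
  lookup-+V a b i = lookup-zipWith _+K_ i a b

  lookup-0V : ∀ i → lookup (0V {n}) i ≡ O
  lookup-0V i = lookup-replicate i O

  +V-comm : ∀ (a b : KV {n}) → a +V b ≡ b +V a
  +V-comm = zipWith-comm +K-comm

  +V-assoc : ∀ (a b c : KV {n}) → (a +V b) +V c ≡ a +V (b +V c)
  +V-assoc = zipWith-assoc +K-assoc

  +V-identityˡ : ∀ (a : KV {n}) → 0V +V a ≡ a
  +V-identityˡ = zipWith-identityˡ λ _ → refl

  +V-identityʳ : ∀ (a : KV {n}) → a +V 0V ≡ a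
  +V-identityʳ a = trans (+V-comm a 0V) (+V-identityˡ a)

  +V-cancelʳ : ∀ (a b : KV {n}) → (a +V b) +V b ≡ a
  +V-cancelʳ a b = begin
    (a +V b) +V b   ≡⟨ +V-assoc a b b ⟩
    a +V (b +V b)   ≡⟨ cong (a +V_) (+V-self b) ⟩
    a +V 0V         ≡⟨ +V-identityʳ a ⟩
    a               ∎
    where open ≡-Reasoning

  +V≡0V⇒≡ : ∀ {a b : KV {n}} → a +V b ≡ 0V → a ≡ b
  +V≡0V⇒≡ {a} {b} a+b≡0 = trans (sym (+V-cancelʳ a b)) (trans (cong (_+V b) a+b≡0) (+V-identityˡ b))

lookup-extensionality : ∀ {n} {A : Set} (u v : Vec A n) → (∀ i → lookup u i ≡ lookup v i) → u ≡ v
lookup-extensionality u v u≗v = trans (sym (tabulate∘lookup u)) (trans (tabulate-cong u≗v) (tabulate∘lookup v))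

lookup-restrict : ∀ {n} (X : Subset n) (a : KV {n}) i → lookup (restrict X a) i ≡ (if lookup X i then lookup a i else O)
lookup-restrict X a i = lookup-zipWith _ i X a

⟨⟩K-restrict : ∀ b x y → ⟨ x , y ⟩K ≡ false → ⟨ (if b then x else O) , y ⟩K ≡ false
⟨⟩K-restrict true  x y ⟨x,y⟩≡false = ⟨x,y⟩≡false
⟨⟩K-restrict false x y _           = refl

sum-single : ∀ {d} (f : Fin d → Bool) x → (∀ i → i ≢ x → f i ≡ false) → sum f ≡ f x
sum-single {suc d} f x off = begin
  sum f                          ≡⟨ sum-remove {i = x} f ⟩
  f x xor sum (f ∘ punchIn x)    ≡⟨ cong (f x xor_) (sum-cong-≗ {d} λ j → off _ (punchInᵢ≢i x j)) ⟩
  f x xor sum {d} (λ _ → false) ≡⟨ cong (f x xor_) (sum-replicate-zero d) ⟩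
  f x xor false                  ≡⟨ xor-identityʳ (f x) ⟩
  f x                            ∎
  where open ≡-Reasoning

module _ {d : ℕ} (f : Fin d → Bool) where

  onlyAt : Fin d → Fin d → Bool
  onlyAt x i = if does (i ≟F x) then f i else false

  onlyAt-≡ : ∀ x → onlyAt x x ≡ f x
  onlyAt-≡ x with x ≟F x
  ... | yes _ = refl
  ... | no x≢x = ⊥-elim (x≢x refl)

  onlyAt-≢ : ∀ {x i} → i ≢ x → onlyAt x i ≡ false
  onlyAt-≢ {x} {i} i≢x with i ≟F x
  ... | yes i≡x = ⊥-elim (i≢x i≡x)
  ... | no _ = refl

  sum-onlyAt : ∀ x → sum (onlyAt x) ≡ f x
  sum-onlyAt x = trans (sum-single (onlyAt x) x λ i → onlyAt-≢) (onlyAt-≡ x)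

  sum-triple : ∀ x y z → x ≢ y → x ≢ z → y ≢ z →
               (∀ i → i ≢ x → i ≢ y → i ≢ z → f i ≡ false) →
               sum f ≡ f x xor (f y xor f z)
  sum-triple x y z x≢y x≢z y≢z off = begin
    sum f                                              ≡⟨ sum-cong-≗ split ⟩
    sum (λ i → onlyAt x i xor (onlyAt y i xor onlyAt z i))
      ≡⟨ ∑-distrib-+ (onlyAt x) _ ⟩
    sum (onlyAt x) xor sum (λ i → onlyAt y i xor onlyAt z i)
      ≡⟨ cong (sum (onlyAt x) xor_) (∑-distrib-+ (onlyAt y) (onlyAt z)) ⟩
    sum (onlyAt x) xor (sum (onlyAt y) xor sum (onlyAt z))
      ≡⟨ cong₂ _xor_ (sum-onlyAt x) (cong₂ _xor_ (sum-onlyAt y) (sum-onlyAt z)) ⟩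
    f x xor (f y xor f z)                              ∎
    where
    open ≡-Reasoning
    split : ∀ i → f i ≡ onlyAt x i xor (onlyAt y i xor onlyAt z i)
    split i with i ≟F x | i ≟F y | i ≟F z
    ... | yes refl | yes x≡y | _        = ⊥-elim (x≢y x≡y)
    ... | yes refl | no _    | yes x≡z  = ⊥-elim (x≢z x≡z)
    ... | yes refl | no _    | no _     = sym (xor-identityʳ (f i))
    ... | no _     | yes refl | yes y≡z = ⊥-elim (y≢z y≡z)
    ... | no _     | yes refl | no _    = sym (xor-identityʳ (f i))
    ... | no _     | no _    | yes refl = refl
    ... | no i≢x   | no i≢y  | no i≢z   = off i i≢x i≢y i≢z

⟨⟩≡sum : ∀ {n} (a b : KV {n}) → ⟨ a , b ⟩ ≡ sum (λ i → ⟨ lookup a i , lookup b i ⟩K)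
⟨⟩≡sum [] [] = refl
⟨⟩≡sum (x ∷ a) (y ∷ b) = cong (⟨ x , y ⟩K xor_) (⟨⟩≡sum a b)

module _ {n : ℕ} (a b : KV {n}) where

  ⟨⟩-single : ∀ v → (∀ i → i ≢ v → ⟨ lookup a i , lookup b i ⟩K ≡ false) →
              ⟨ a , b ⟩ ≡ ⟨ lookup a v , lookup b v ⟩K
  ⟨⟩-single v off = trans (⟨⟩≡sum a b) (sum-single _ v off)

  ⟨⟩-triple : ∀ x y z → x ≢ y → x ≢ z → y ≢ z →
              (∀ i → i ≢ x → i ≢ y → i ≢ z → lookup b i ≡ O) →
              ⟨ a , b ⟩ ≡ ⟨ lookup a x , lookup b x ⟩K xor
                          (⟨ lookup a y , lookup b y ⟩K xor ⟨ lookup a z , lookup b z ⟩K)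
  ⟨⟩-triple x y z x≢y x≢z y≢z off = trans (⟨⟩≡sum a b) (sum-triple _ x y z x≢y x≢z y≢z
    λ i i≢x i≢y i≢z → trans (cong (⟨ lookup a i ,_⟩K) (off i i≢x i≢y i≢z)) (⟨⟩K-zeroʳ (lookup a i)))

module _ {n : ℕ} where

  InSpan : ∀ {d} → Vec (KV {n}) d → KV {n} → Set
  InSpan bs x = ∃ λ cs → combo bs cs ≡ x

  Independent : ∀ {d} → Vec (KV {n}) d → Set
  Independent {d} bs = ∀ cs → combo bs cs ≡ 0V → cs ≡ replicate d false

  +V-interchange : ∀ (a b c d : KV {n}) → (a +V b) +V (c +V d) ≡ (a +V c) +V (b +V d)
  +V-interchange a b c d = begin
    (a +V b) +V (c +V d)   ≡⟨ +V-assoc a b (c +V d) ⟩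
    a +V (b +V (c +V d))   ≡⟨ cong (a +V_) (sym (+V-assoc b c d)) ⟩
    a +V ((b +V c) +V d)   ≡⟨ cong (λ e → a +V (e +V d)) (+V-comm b c) ⟩
    a +V ((c +V b) +V d)   ≡⟨ cong (a +V_) (+V-assoc c b d) ⟩
    a +V (c +V (b +V d))   ≡⟨ sym (+V-assoc a c (b +V d)) ⟩
    (a +V c) +V (b +V d)   ∎
    where open ≡-Reasoning

  combo-replicate-false : ∀ {d} (bs : Vec (KV {n}) d) → combo bs (replicate d false) ≡ 0V
  combo-replicate-false [] = refl
  combo-replicate-false (b ∷ bs) = trans (+V-identityˡ _) (combo-replicate-false bs)

  combo-xor : ∀ {d} (bs : Vec (KV {n}) d) cs ds →
              combo bs (zipWith _xor_ cs ds) ≡ combo bs cs +V combo bs ds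
  combo-xor [] [] [] = sym (+V-identityˡ 0V)
  combo-xor (b ∷ bs) (c ∷ cs) (e ∷ ds) =
    trans (cong₂ _+V_ (scale-xor c e) (combo-xor bs cs ds))
          (+V-interchange (if c then b else 0V) (if e then b else 0V) (combo bs cs) (combo bs ds))
    where
    scale-xor : ∀ c e → (if c xor e then b else 0V) ≡ (if c then b else 0V) +V (if e then b else 0V)
    scale-xor true  true  = sym (+V-self b)
    scale-xor true  false = sym (+V-identityʳ b)
    scale-xor false true  = sym (+V-identityˡ b)
    scale-xor false false = sym (+V-identityˡ 0V)

  combo-++ : ∀ {d e} (bs : Vec (KV {n}) d) (bs′ : Vec (KV {n}) e) cs cs′ →
             combo (bs ++ bs′) (cs ++ cs′) ≡ combo bs cs +V combo bs′ cs′
  combo-++ [] bs′ [] cs′ = sym (+V-identityˡ _)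
  combo-++ (b ∷ bs) bs′ (c ∷ cs) cs′ =
    trans (cong ((if c then b else 0V) +V_) (combo-++ bs bs′ cs cs′))
          (sym (+V-assoc (if c then b else 0V) (combo bs cs) (combo bs′ cs′)))

  ⟨⟩K-combo : ∀ {d} (bs : Vec (KV {n}) d) cs w y →
    ⟨ lookup (combo bs cs) w , y ⟩K ≡ sum (λ j → lookup cs j ∧ ⟨ lookup (lookup bs j) w , y ⟩K)
  ⟨⟩K-combo [] [] w y = cong (⟨_, y ⟩K) (lookup-0V w)
  ⟨⟩K-combo (b ∷ bs) (c ∷ cs) w y = begin
    ⟨ lookup ((if c then b else 0V) +V combo bs cs) w , y ⟩K
      ≡⟨ cong (⟨_, y ⟩K) (lookup-+V (if c then b else 0V) (combo bs cs) w) ⟩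
    ⟨ lookup (if c then b else 0V) w +K lookup (combo bs cs) w , y ⟩K
      ≡⟨ ⟨⟩K-distribʳ-+K (lookup (if c then b else 0V) w) _ y ⟩
    ⟨ lookup (if c then b else 0V) w , y ⟩K xor ⟨ lookup (combo bs cs) w , y ⟩K
      ≡⟨ cong₂ _xor_ (scaled c) (⟨⟩K-combo bs cs w y) ⟩
    (c ∧ ⟨ lookup b w , y ⟩K) xor sum (λ j → lookup cs j ∧ ⟨ lookup (lookup bs j) w , y ⟩K) ∎
    where
    open ≡-Reasoning
    scaled : ∀ c → ⟨ lookup (if c then b else 0V) w , y ⟩K ≡ (c ∧ ⟨ lookup b w , y ⟩K)
    scaled true  = refl
    scaled false = cong (⟨_, y ⟩K) (lookup-0V w)

module _ {n : ℕ} (S : IsotropicSystem n) where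
  open IsotropicSystem S

  combo-closed : ∀ {d} (bs : Vec (KV {n}) d) cs → All L bs → L (combo bs cs)
  combo-closed [] [] [] = L-zero
  combo-closed (b ∷ bs) (c ∷ cs) (b∈L ∷ bs⊆L) = L-add _ _ (scaled c) (combo-closed bs cs bs⊆L)
    where
    scaled : ∀ c → L (if c then b else 0V)
    scaled true  = b∈L
    scaled false = L-zero

encode : ∀ {d} → Vec Bool d → Fin (2 ^ d)
encode []      = zero
encode (b ∷ v) = combine (Inverse.from 2↔Bool b) (encode v)

decode : ∀ d → Fin (2 ^ d) → Vec Bool d
decode zero    _ = []
decode (suc d) i = Inverse.to 2↔Bool (proj₁ (remQuot {2} (2 ^ d) i)) ∷ decode d (proj₂ (remQuot {2} (2 ^ d) i))

decode-encode : ∀ {d} (v : Vec Bool d) → decode d (encode v) ≡ v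
decode-encode []          = refl
decode-encode {suc d} (b ∷ v) = begin
  decode (suc d) (combine (from b) (encode v))
    ≡⟨ cong (λ r → to (proj₁ r) ∷ decode d (proj₂ r)) (remQuot-combine {k = 2 ^ d} (from b) (encode v)) ⟩
  to (from b) ∷ decode d (encode v)
    ≡⟨ cong₂ _∷_ (strictlyInverseˡ b) (decode-encode v) ⟩
  b ∷ v ∎
  where
  open ≡-Reasoning
  open Inverse 2↔Bool

encode-decode : ∀ d (i : Fin (2 ^ d)) → encode (decode d i) ≡ i
encode-decode zero    zero = refl
encode-decode (suc d) i    = begin
  combine (from (to x)) (encode (decode d j)) ≡⟨ cong₂ combine (strictlyInverseʳ x) (encode-decode d j) ⟩
  combine x j                                  ≡⟨ combine-remQuot {2} (2 ^ d) i ⟩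
  i                                            ∎
  where
  open ≡-Reasoning
  open Inverse 2↔Bool
  x : Fin 2
  x = proj₁ (remQuot {2} (2 ^ d) i)
  j : Fin (2 ^ d)
  j = proj₂ (remQuot {2} (2 ^ d) i)

Vec-Bool-injection⇒≤ : ∀ {a b} (F : Vec Bool a → Vec Bool b) → Injective _≡_ _≡_ F → a ≤ b
Vec-Bool-injection⇒≤ {a} {b} F F-injective = ≮⇒≥ λ b<a →
  <⇒≱ (^-monoʳ-< 2 (s≤s (s≤s z≤n)) b<a) (injective⇒≤ G-injective)
  where
  G : Fin (2 ^ a) → Fin (2 ^ b)
  G = encode ∘ F ∘ decode a
  G-injective : Injective _≡_ _≡_ G
  G-injective {i} {j} Gi≡Gj = begin
    i                    ≡⟨ sym (encode-decode a i) ⟩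
    encode (decode a i)  ≡⟨ cong encode (F-injective (begin
      F (decode a i)                   ≡⟨ sym (decode-encode _) ⟩
      decode b (G i)                   ≡⟨ cong (decode b) Gi≡Gj ⟩
      decode b (G j)                   ≡⟨ decode-encode _ ⟩
      F (decode a j)                   ∎)) ⟩
    encode (decode a j)  ≡⟨ encode-decode a j ⟩
    j                    ∎
    where open ≡-Reasoning

module _ {n : ℕ} where

  InSpan? : ∀ {d} (bs : Vec (KV {n}) d) x → Dec (InSpan bs x)
  InSpan? {d} bs x with any? (λ i → ≡-dec _≟K_ (combo bs (decode d i)) x)
  ... | yes (i , e) = yes (decode d i , e)
  ... | no ∄i = no λ (cs , e) → ∄i (encode cs , trans (cong (combo bs) (decode-encode cs)) e)

  respan : ∀ {a b} (bs : Vec (KV {n}) a) (ss : Vec (KV {n}) b) →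
           (∀ i → InSpan ss (lookup bs i)) → Vec Bool a → Vec Bool b
  respan []       ss _      []       = replicate _ false
  respan (_ ∷ bs) ss coords (c ∷ cs) =
    zipWith _xor_ (if c then proj₁ (coords zero) else replicate _ false) (respan bs ss (coords ∘ suc) cs)

  combo-respan : ∀ {a b} (bs : Vec (KV {n}) a) (ss : Vec (KV {n}) b) coords cs →
                 combo ss (respan bs ss coords cs) ≡ combo bs cs
  combo-respan []       ss coords []       = combo-replicate-false ss
  combo-respan (b ∷ bs) ss coords (c ∷ cs) =
    trans (combo-xor ss _ _) (cong₂ _+V_ (scaled c) (combo-respan bs ss (coords ∘ suc) cs))
    where
    scaled : ∀ c → combo ss (if c then proj₁ (coords zero) else replicate _ false) ≡ (if c then b else 0V)
    scaled true  = proj₂ (coords zero)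
    scaled false = combo-replicate-false ss

  independent-in-span⇒≤ : ∀ {a b} (bs : Vec (KV {n}) a) (ss : Vec (KV {n}) b) →
                          Independent bs → (∀ i → InSpan ss (lookup bs i)) → a ≤ b
  independent-in-span⇒≤ bs ss bs-independent coords =
    Vec-Bool-injection⇒≤ (respan bs ss coords) λ {x} {y} e → xor-cancel x y (bs-independent _ (begin
      combo bs (zipWith _xor_ x y)   ≡⟨ combo-xor bs x y ⟩
      combo bs x +V combo bs y       ≡⟨ cong (_+V combo bs y) (sym (combo-respan bs ss coords x)) ⟩
      combo ss (respan bs ss coords x) +V combo bs y
        ≡⟨ cong (λ z → combo ss z +V combo bs y) e ⟩
      combo ss (respan bs ss coords y) +V combo bs y
        ≡⟨ cong (_+V combo bs y) (combo-respan bs ss coords y) ⟩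
      combo bs y +V combo bs y       ≡⟨ +V-self (combo bs y) ⟩
      0V                             ∎))
    where
    open ≡-Reasoning
    xor-cancel : ∀ {d} (x y : Vec Bool d) → zipWith _xor_ x y ≡ replicate d false → x ≡ y
    xor-cancel []            []            _ = refl
    xor-cancel (true  ∷ x) (true  ∷ y) e = cong (true ∷_) (xor-cancel x y (cong tail e))
    xor-cancel (false ∷ x) (false ∷ y) e = cong (false ∷_) (xor-cancel x y (cong tail e))
    xor-cancel (true  ∷ x) (false ∷ y) ()
    xor-cancel (false ∷ x) (true  ∷ y) ()

  InSpan-∷ : ∀ {d} (bs : Vec (KV {n}) d) b {x} → InSpan bs x → InSpan (b ∷ bs) x
  InSpan-∷ bs b (cs , e) = false ∷ cs , trans (+V-identityˡ _) e

  InSpan-head : ∀ {d} (bs : Vec (KV {n}) d) b → InSpan (b ∷ bs) b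
  InSpan-head bs b = true ∷ replicate _ false , trans (cong (b +V_) (combo-replicate-false bs)) (+V-identityʳ b)

  Independent-∷ : ∀ {d} (bs : Vec (KV {n}) d) b → Independent bs → ¬ InSpan bs b → Independent (b ∷ bs)
  Independent-∷ bs b _ b∉span (true ∷ cs) e = ⊥-elim (b∉span (cs , sym (+V≡0V⇒≡ e)))
  Independent-∷ bs b bs-independent _ (false ∷ cs) e = cong (false ∷_) (bs-independent cs (trans (sym (+V-identityˡ _)) e))

  InSpan-++⁺ˡ : ∀ {d e} (bs : Vec (KV {n}) d) (gs : Vec (KV {n}) e) {x} → InSpan bs x → InSpan (bs ++ gs) x
  InSpan-++⁺ˡ bs gs (cs , combo≡x) = cs ++ replicate _ false ,
    trans (combo-++ bs gs cs _) (trans (cong₂ _+V_ combo≡x (combo-replicate-false gs)) (+V-identityʳ _))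

  InSpan-+V-∷ʳ : ∀ {d} (bs : Vec (KV {n}) d) g {x} → InSpan bs (x +V g) → InSpan (bs ++ g ∷ []) x
  InSpan-+V-∷ʳ bs g {x} (cs , combo≡x+g) = cs ++ true ∷ [] ,
    trans (combo-++ bs (g ∷ []) cs (true ∷ [])) (trans (cong₂ _+V_ combo≡x+g (+V-identityʳ g)) (+V-cancelʳ x g))

allKV : ∀ n → List (KV {n})
allKV zero    = [] ∷ []
allKV (suc n) = cartesianProductWith _∷_ (O ∷ α ∷ β ∷ γ ∷ []) (allKV n)

∈-allKV : ∀ {n} (a : KV {n}) → a ∈ allKV n
∈-allKV []      = here refl
∈-allKV (x ∷ a) = ∈-cartesianProductWith⁺ _∷_ (∈-allK x) (∈-allKV a)
  where
  ∈-allK : ∀ x → x ∈ O ∷ α ∷ β ∷ γ ∷ []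
  ∈-allK O = here refl
  ∈-allK α = there (here refl)
  ∈-allK β = there (there (here refl))
  ∈-allK γ = there (there (there (here refl)))

module _ {n : ℕ} (W : KV {n} → Set) (W? : Decidable W) where

  BasisExtension : ∀ {d} → Vec (KV {n}) d → List (KV {n}) → Set
  BasisExtension bs xs = ∃ λ d′ → Σ (Vec (KV {n}) d′) λ bs′ → All W bs′ × Independent bs′ ×
    (∀ y → InSpan bs y ⊎ (y ∈ xs × W y) → InSpan bs′ y)

  extension-skip : ∀ {d} (bs : Vec (KV {n}) d) x xs → (W x → InSpan bs x) → BasisExtension bs xs → BasisExtension bs (x ∷ xs)
  extension-skip bs x xs x-spanned (d′ , bs′ , bs′⊆W , bs′-independent , spans) =
    d′ , bs′ , bs′⊆W , bs′-independent , λ where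
      y (inj₁ y∈span)             → spans y (inj₁ y∈span)
      y (inj₂ (here refl , y∈W))  → spans y (inj₁ (x-spanned y∈W))
      y (inj₂ (there y∈xs , y∈W)) → spans y (inj₂ (y∈xs , y∈W))

  extension-adjoin : ∀ {d} (bs : Vec (KV {n}) d) x xs → BasisExtension (x ∷ bs) xs → BasisExtension bs (x ∷ xs)
  extension-adjoin bs x xs (d′ , bs′ , bs′⊆W , bs′-independent , spans) =
    d′ , bs′ , bs′⊆W , bs′-independent , λ where
      y (inj₁ y∈span)             → spans y (inj₁ (InSpan-∷ bs x y∈span))
      y (inj₂ (here refl , _))    → spans y (inj₁ (InSpan-head bs x))
      y (inj₂ (there y∈xs , y∈W)) → spans y (inj₂ (y∈xs , y∈W))

  extend-basis : ∀ {d} (bs : Vec (KV {n}) d) → All W bs → Independent bs → ∀ xs → BasisExtension bs xs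
  extend-basis bs bs⊆W bs-independent [] =
    _ , bs , bs⊆W , bs-independent , λ { y (inj₁ y∈span) → y∈span ; y (inj₂ (() , _)) }
  extend-basis bs bs⊆W bs-independent (x ∷ xs) with W? x | InSpan? bs x
  ... | yes x∈W | no x∉span =
    extension-adjoin bs x xs (extend-basis (x ∷ bs) (x∈W ∷ bs⊆W) (Independent-∷ bs x bs-independent x∉span) xs)
  ... | yes _ | yes x∈span = extension-skip bs x xs (λ _ → x∈span) (extend-basis bs bs⊆W bs-independent xs)
  ... | no x∉W | _ = extension-skip bs x xs (λ x∈W → ⊥-elim (x∉W x∈W)) (extend-basis bs bs⊆W bs-independent xs)

  dimension-exists : ∃ (HasDim W)
  dimension-exists =
    let d , bs , bs⊆W , bs-independent , spans = extend-basis [] [] (λ { [] _ → refl }) (allKV n)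
    in d , bs , bs⊆W , bs-independent , λ a a∈W → spans a (inj₂ (∈-allKV a , a∈W))

injective-into⇒≤∣∣ : ∀ {r n} (f : Fin r → Fin n) → Injective _≡_ _≡_ f →
                     (X : Subset n) → (∀ j → f j ∈ₛ X) → r ≤ ∣ X ∣
injective-into⇒≤∣∣ {zero}  f f-injective X f∈X = z≤n
injective-into⇒≤∣∣ {suc r} f f-injective X f∈X = ≤-trans
  (s≤s (injective-into⇒≤∣∣ (f ∘ suc) (suc-injective ∘ f-injective) (X - f zero)
     λ j → x∈p∧x≢y⇒x∈p-y (f∈X (suc j)) (0≢1+n ∘ sym ∘ f-injective)))
  (x∈p⇒∣p-x∣<∣p∣ (f∈X zero))

∣p∪q∣≤∣p∣+∣q∣ : ∀ {n} (p q : Subset n) → ∣ p ∪ q ∣ ≤ ∣ p ∣ + ∣ q ∣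
∣p∪q∣≤∣p∣+∣q∣ [] [] = z≤n
∣p∪q∣≤∣p∣+∣q∣ (outside ∷ p) (outside ∷ q) = ∣p∪q∣≤∣p∣+∣q∣ p q
∣p∪q∣≤∣p∣+∣q∣ (outside ∷ p) (inside  ∷ q) =
  ≤-trans (s≤s (∣p∪q∣≤∣p∣+∣q∣ p q)) (≤-reflexive (sym (+-suc ∣ p ∣ ∣ q ∣)))
∣p∪q∣≤∣p∣+∣q∣ (inside  ∷ p) (outside ∷ q) = s≤s (∣p∪q∣≤∣p∣+∣q∣ p q)
∣p∪q∣≤∣p∣+∣q∣ (inside  ∷ p) (inside  ∷ q) =
  s≤s (≤-trans (∣p∪q∣≤∣p∣+∣q∣ p q) (≤-trans (n≤1+n _) (≤-reflexive (sym (+-suc ∣ p ∣ ∣ q ∣)))))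

distinct∈⇒2≤∣∣ : ∀ {n} (X : Subset n) {x y} → x ≢ y → x ∈ₛ X → y ∈ₛ X → 2 ≤ ∣ X ∣
distinct∈⇒2≤∣∣ {n} X {x} {y} x≢y x∈X y∈X = injective-into⇒≤∣∣ pair pair-injective X λ where
    zero       → x∈X
    (suc zero) → y∈X
  where
  pair : Fin 2 → Fin n
  pair zero       = x
  pair (suc zero) = y
  pair-injective : Injective _≡_ _≡_ pair
  pair-injective {zero}     {zero}     _ = refl
  pair-injective {zero}     {suc zero} e = ⊥-elim (x≢y e)
  pair-injective {suc zero} {zero}     e = ⊥-elim (x≢y (sym e))
  pair-injective {suc zero} {suc zero} _ = refl

∈⇒1≤∣∣ : ∀ {n} {X : Subset n} {x} → x ∈ₛ X → 1 ≤ ∣ X ∣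
∈⇒1≤∣∣ x∈X = ≤-trans (s≤s z≤n) (x∈p⇒∣p-x∣<∣p∣ x∈X)

-- Isotropic systems

HasDim⇒1≤ : ∀ {n} {W : KV {n} → Set} {d} → HasDim W d → ∀ u → W u → u ≢ 0V → 1 ≤ d
HasDim⇒1≤ {d = zero} ([] , _ , _ , spans) u u∈W u≢0 with spans u u∈W
... | [] , 0V≡u = ⊥-elim (u≢0 (sym 0V≡u))
HasDim⇒1≤ {d = suc d} _ _ _ _ = s≤s z≤n

module _ {n : ℕ} (S : IsotropicSystem n) where
  open IsotropicSystem S

  L? : Decidable L
  L? a with InSpan? (proj₁ L-dim) a
  ... | yes (cs , e) = yes (subst L e (combo-closed S _ cs (proj₁ (proj₂ L-dim))))
  ... | no a∉span = no λ a∈L → a∉span (proj₂ (proj₂ (proj₂ L-dim)) a a∈L)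

  LIn? : ∀ X → Decidable (LIn S X)
  LIn? X a = L? a ×-dec all? (λ i → ¬? (lookup a i ≟K O) →-dec (i ∈? X))

  LIn-dimension : ∀ X → ∃ (HasDim (LIn S X))
  LIn-dimension X = dimension-exists (LIn S X) (LIn? X)

  module _ (3-connected : ThreeConnected S) where

    no-vector-on-two-points : ∀ {x y} z → x ≢ y → L z → z ≢ 0V → (∀ i → i ≢ x → i ≢ y → lookup z i ≡ O) →
                              ∀ {u v} → u ≢ v → u ≢ x → u ≢ y → v ≢ x → v ≢ y → ⊥
    no-vector-on-two-points {x} {y} z x≢y z∈L z≢0 z-support {u} {v} u≢v u≢x u≢y v≢x v≢y =
      proj₂ (3-connected X) (2≤∣X∣ , 2≤∣∁X∣ , d , dim , s≤s (∸-mono ∣X∣≤2 (HasDim⇒1≤ dim z (z∈L , z⊆X) z≢0)))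
      where
      X : Subset n
      X = ⁅ x ⁆ ∪ ⁅ y ⁆
      x∈X : x ∈ₛ X
      x∈X = x∈p∪q⁺ (inj₁ (x∈⁅x⁆ x))
      y∈X : y ∈ₛ X
      y∈X = x∈p∪q⁺ (inj₂ (x∈⁅x⁆ y))
      ∉X : ∀ {w} → w ≢ x → w ≢ y → w ∈ₛ ∁ X
      ∉X {w} w≢x w≢y = x∉p⇒x∈∁p λ w∈X → case x∈p∪q⁻ ⁅ x ⁆ ⁅ y ⁆ w∈X of λ where
        (inj₁ w∈⁅x⁆) → w≢x (x∈⁅y⁆⇒x≡y x w∈⁅x⁆)
        (inj₂ w∈⁅y⁆) → w≢y (x∈⁅y⁆⇒x≡y y w∈⁅y⁆)
      z⊆X : SuppIn z X
      z⊆X i zᵢ≢O with i ≟F x | i ≟F y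
      ... | yes refl | _        = x∈X
      ... | no _     | yes refl = y∈X
      ... | no i≢x   | no i≢y   = ⊥-elim (zᵢ≢O (z-support i i≢x i≢y))
      2≤∣X∣ : 2 ≤ ∣ X ∣
      2≤∣X∣ = distinct∈⇒2≤∣∣ X x≢y x∈X y∈X
      2≤∣∁X∣ : 2 ≤ ∣ ∁ X ∣
      2≤∣∁X∣ = distinct∈⇒2≤∣∣ (∁ X) u≢v (∉X u≢x u≢y) (∉X v≢x v≢y)
      ∣X∣≤2 : ∣ X ∣ ≤ 2
      ∣X∣≤2 = ≤-trans (∣p∪q∣≤∣p∣+∣q∣ ⁅ x ⁆ ⁅ y ⁆) (≤-reflexive (cong₂ _+_ (∣⁅x⁆∣≡1 x) (∣⁅x⁆∣≡1 y)))
      d : ℕ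
      d = proj₁ (LIn-dimension X)
      dim : HasDim (LIn S X) d
      dim = proj₂ (LIn-dimension X)

  Bv⇒Eulerian : ∀ a → Complete a → (∀ v → ∃ (IsBv S a v)) → Eulerian S a
  Bv⇒Eulerian a a-complete bv = a-complete , λ X (v , v∈X) a[X]∈L →
    let b , b∈L , bᵥ , b-off = bv v
        open ≡-Reasoning
        a[X]ᵢ-⊥-bᵢ : ∀ i → i ≢ v → ⟨ lookup (restrict X a) i , lookup b i ⟩K ≡ false
        a[X]ᵢ-⊥-bᵢ i i≢v = trans (cong (⟨_, lookup b i ⟩K) (lookup-restrict X a i))
          (⟨⟩K-restrict (lookup X i) (lookup a i) (lookup b i) (trans (⟨⟩K-sym _ _) (b-off i i≢v)))
    in case (begin
      false                                                 ≡⟨ L-isotr _ _ a[X]∈L b∈L ⟨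
      ⟨ restrict X a , b ⟩                                  ≡⟨ ⟨⟩-single (restrict X a) b v a[X]ᵢ-⊥-bᵢ ⟩
      ⟨ lookup (restrict X a) v , lookup b v ⟩K             ≡⟨ cong (⟨_, lookup b v ⟩K) (lookup-restrict X a v) ⟩
      ⟨ (if lookup X v then lookup a v else O) , lookup b v ⟩K
        ≡⟨ cong (λ c → ⟨ (if c then lookup a v else O) , lookup b v ⟩K) ([]=⇒lookup v∈X) ⟩
      ⟨ lookup a v , lookup b v ⟩K                          ≡⟨ ⟨⟩K-sym _ _ ⟩
      ⟨ lookup b v , lookup a v ⟩K                          ≡⟨ bᵥ ⟩
      true                                                  ∎) of λ ()

  Eulerian⇒orthogonal-vanishes : ∀ {a z} → Eulerian S a → L z →
    (∀ i → ⟨ lookup z i , lookup a i ⟩K ≡ false) → ∀ i → lookup z i ≡ O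
  Eulerian⇒orthogonal-vanishes {a} {z} (a-complete , a-eulerian) z∈L z⊥a i with lookup z i ≟K O in zᵢ?
  ... | yes zᵢ≡O = zᵢ≡O
  ... | no  zᵢ≢O = ⊥-elim (a-eulerian Y (i , i∈Y) (subst L (lookup-extensionality z (restrict Y a) z≗a[Y]) z∈L))
    where
    Y : Subset n
    Y = tabulate λ j → not (does (lookup z j ≟K O))
    i∈Y : i ∈ₛ Y
    i∈Y = lookup⇒[]= i Y (trans (lookup∘tabulate _ i) (cong (not ∘ does) zᵢ?))
    z≗a[Y] : ∀ j → lookup z j ≡ lookup (restrict Y a) j
    z≗a[Y] j rewrite lookup-restrict Y a j | lookup∘tabulate (λ j → not (does (lookup z j ≟K O))) j
      with lookup z j ≟K O
    ... | yes zⱼ≡O = zⱼ≡O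
    ... | no  zⱼ≢O with ⟨⟩K≡false⇒O⊎≡ (lookup z j) (lookup a j) (a-complete j) (z⊥a j)
    ...   | inj₁ zⱼ≡O = ⊥-elim (zⱼ≢O zⱼ≡O)
    ...   | inj₂ zⱼ≡aⱼ = zⱼ≡aⱼ

  IsBv-unique : ∀ {a v b b′} → Eulerian S a → IsBv S a v b → IsBv S a v b′ → ∀ i → lookup b i ≡ lookup b′ i
  IsBv-unique {a} {v} {b} {b′} a-eulerian (b∈L , bᵥ , b-off) (b′∈L , b′ᵥ , b′-off) i =
    +K-cancel _ _ (trans (sym (lookup-+V b b′ i))
      (Eulerian⇒orthogonal-vanishes a-eulerian (L-add b b′ b∈L b′∈L) b+b′⊥a i))
    where
    b+b′⊥a : ∀ j → ⟨ lookup (b +V b′) j , lookup a j ⟩K ≡ false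
    b+b′⊥a j rewrite lookup-+V b b′ j | ⟨⟩K-distribʳ-+K (lookup b j) (lookup b′ j) (lookup a j) with j ≟F v
    ... | yes refl = cong₂ _xor_ bᵥ b′ᵥ
    ... | no j≢v   = cong₂ _xor_ (b-off j j≢v) (b′-off j j≢v)

ExactSupport : ∀ {n} → KV {n} → Fin n → Fin n → Fin n → Set
ExactSupport t x y z = ∀ u → (lookup t u ≢ O) ⇔ (u ≡ x ⊎ u ≡ y ⊎ u ≡ z)

module ExactSupport {n} {t : KV {n}} {x y z} (support : ExactSupport t x y z) where

  nonzero₀ : lookup t x ≢ O
  nonzero₀ = Equivalence.from (support x) (inj₁ refl)

  nonzero₁ : lookup t y ≢ O
  nonzero₁ = Equivalence.from (support y) (inj₂ (inj₁ refl))

  nonzero₂ : lookup t z ≢ O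
  nonzero₂ = Equivalence.from (support z) (inj₂ (inj₂ refl))

  vanishes : ∀ u → u ≢ x → u ≢ y → u ≢ z → lookup t u ≡ O
  vanishes u u≢x u≢y u≢z with lookup t u ≟K O
  ... | yes tᵤ≡O = tᵤ≡O
  ... | no tᵤ≢O with Equivalence.to (support u) tᵤ≢O
  ...   | inj₁ u≡x        = ⊥-elim (u≢x u≡x)
  ...   | inj₂ (inj₁ u≡y) = ⊥-elim (u≢y u≡y)
  ...   | inj₂ (inj₂ u≡z) = ⊥-elim (u≢z u≡z)

  nonzero⇒ : ∀ u → lookup t u ≢ O → u ≡ x ⊎ u ≡ y ⊎ u ≡ z
  nonzero⇒ u = Equivalence.to (support u)

  ⟨⟩-expand : ∀ v → x ≢ y → x ≢ z → y ≢ z →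
    ⟨ v , t ⟩ ≡ ⟨ lookup v x , lookup t x ⟩K xor (⟨ lookup v y , lookup t y ⟩K xor ⟨ lookup v z , lookup t z ⟩K)
  ⟨⟩-expand v x≢y x≢z y≢z = ⟨⟩-triple v t x y z x≢y x≢z y≢z vanishes

-- Cyclic indices

module Cycle (ℓ : ℕ) where

  N : ℕ
  N = suc ℓ

  sh : Fin N → Fin N
  sh i = fromℕ< (m%n<n (suc (toℕ i)) N)

  sh-toℕ : ∀ i → toℕ (sh i) ≡ suc (toℕ i) % N
  sh-toℕ i = toℕ-fromℕ< _

  shⁿ : ℕ → Fin N → Fin N
  shⁿ zero    i = i
  shⁿ (suc j) i = sh (shⁿ j i)

  shⁿ-sh : ∀ j i → shⁿ j (sh i) ≡ sh (shⁿ j i)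
  shⁿ-sh zero    i = refl
  shⁿ-sh (suc j) i = cong sh (shⁿ-sh j i)

  suc-% : ∀ x → suc (x % N) % N ≡ suc x % N
  suc-% x = begin
    suc (x % N) % N            ≡⟨ %-distribˡ-+ 1 (x % N) N ⟩
    (1 % N + x % N % N) % N    ≡⟨ cong (λ t → (1 % N + t) % N) (m%n%n≡m%n x N) ⟩
    (1 % N + x % N) % N        ≡⟨ sym (%-distribˡ-+ 1 x N) ⟩
    suc x % N                  ∎
    where open ≡-Reasoning

  shⁿ-toℕ : ∀ j i → toℕ (shⁿ j i) ≡ (toℕ i + j) % N
  shⁿ-toℕ zero    i = sym (trans (cong (_% N) (+-identityʳ (toℕ i))) (m<n⇒m%n≡m (toℕ<n i)))
  shⁿ-toℕ (suc j) i = begin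
    toℕ (sh (shⁿ j i))         ≡⟨ sh-toℕ (shⁿ j i) ⟩
    suc (toℕ (shⁿ j i)) % N    ≡⟨ cong (λ t → suc t % N) (shⁿ-toℕ j i) ⟩
    suc ((toℕ i + j) % N) % N  ≡⟨ suc-% (toℕ i + j) ⟩
    suc (toℕ i + j) % N        ≡⟨ cong (_% N) (sym (+-suc (toℕ i) j)) ⟩
    (toℕ i + suc j) % N        ∎
    where open ≡-Reasoning

  shⁿ-N : ∀ i → shⁿ N i ≡ i
  shⁿ-N i = toℕ-injective (begin
    toℕ (shⁿ N i)   ≡⟨ shⁿ-toℕ N i ⟩
    (toℕ i + N) % N ≡⟨ [m+n]%n≡m%n (toℕ i) N ⟩
    toℕ i % N       ≡⟨ m<n⇒m%n≡m (toℕ<n i) ⟩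
    toℕ i           ∎)
    where open ≡-Reasoning

  shⁿ-≢ : ∀ j i → 1 ≤ j → j ≤ ℓ → shⁿ j i ≢ i
  shⁿ-≢ j i 1≤j j≤ℓ shʲi≡i = not-a-multiple ((x + j) / N) (+-cancelˡ-≡ x j _ (begin
    x + j                            ≡⟨ m≡m%n+[m/n]*n (x + j) N ⟩
    (x + j) % N + (x + j) / N * N    ≡⟨ cong (_+ (x + j) / N * N) (trans (sym (shⁿ-toℕ j i)) (cong toℕ shʲi≡i)) ⟩
    x + (x + j) / N * N              ∎))
    where
    open ≡-Reasoning
    x : ℕ
    x = toℕ i
    not-a-multiple : ∀ q → j ≢ q * N
    not-a-multiple zero    j≡0    = n≮n 0 (subst (0 <_) j≡0 1≤j)
    not-a-multiple (suc q) j≡N+qN = n≮n ℓ (≤-trans (m≤m+n N (q * N)) (subst (_≤ ℓ) j≡N+qN j≤ℓ))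

  pr : Fin N → Fin N
  pr = shⁿ ℓ

  sh-pr : ∀ i → sh (pr i) ≡ i
  sh-pr = shⁿ-N

  pr-sh : ∀ i → pr (sh i) ≡ i
  pr-sh i = trans (shⁿ-sh ℓ i) (shⁿ-N i)

  last : Fin N
  last = fromℕ ℓ

  sh-last : sh last ≡ zero
  sh-last = toℕ-injective (trans (sh-toℕ last) (trans (cong (λ t → suc t % N) (toℕ-fromℕ ℓ)) (n%n≡0 N)))

  pr-zero : pr zero ≡ last
  pr-zero = trans (cong pr (sym sh-last)) (pr-sh last)

  sh≢zero : ∀ {s} → s ≢ last → sh s ≢ zero
  sh≢zero {s} s≢last s₁≡0 = s≢last (trans (sym (pr-sh s)) (trans (cong pr s₁≡0) pr-zero))

  pr≢last : ∀ {c} → c ≢ zero → pr c ≢ last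
  pr≢last {c} c≢0 pr-c≡last = c≢0 (trans (sym (sh-pr c)) (trans (cong sh pr-c≡last) sh-last))

  sh²-pr² : ∀ w → shⁿ 2 (pr (pr w)) ≡ w
  sh²-pr² w = trans (cong sh (sh-pr (pr w))) (sh-pr w)

  pr²-sh² : ∀ s → pr (pr (shⁿ 2 s)) ≡ s
  pr²-sh² s = trans (cong pr (pr-sh (sh s))) (pr-sh s)

  inject₁≢last : ∀ (j : Fin ℓ) → inject₁ j ≢ last
  inject₁≢last j = fromℕ≢inject₁ ∘ sym

  sh-inject₁ : ∀ (j : Fin ℓ) → sh (inject₁ j) ≡ suc j
  sh-inject₁ j = toℕ-injective (begin
    toℕ (sh (inject₁ j))        ≡⟨ sh-toℕ (inject₁ j) ⟩
    suc (toℕ (inject₁ j)) % N   ≡⟨ cong (λ t → suc t % N) (toℕ-inject₁ j) ⟩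
    suc (toℕ j) % N             ≡⟨ m<n⇒m%n≡m (s≤s (toℕ<n j)) ⟩
    suc (toℕ j)                 ∎)
    where open ≡-Reasoning

-- Fundamental graphs from framed triangles

module FundamentalCycle {n : ℕ} (S : IsotropicSystem n) (ℓ : ℕ)
  (p : Fin (suc ℓ) → Fin n) (p-injective : Injective _≡_ _≡_ p)
  (pos : Fin n → Fin (suc ℓ)) (p-pos : ∀ y → p (pos y) ≡ y) (a : Fin (suc ℓ) → K) where

  open IsotropicSystem S
  open Cycle ℓ

  -- Framed triangles are the vectors b_v of the Eulerian vector built from a (t-IsBv).
  record FramedTriangle (s : Fin N) (t : KV {n}) : Set where
    field
      ∈L      : L t
      at-s    : lookup t (p s) ≡ a s
      at-sh   : ⟨ lookup t (p (sh s)) , a (sh s) ⟩K ≡ true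
      at-sh²  : lookup t (p (shⁿ 2 s)) ≡ a (shⁿ 2 s)
      support : ∀ w → lookup t (p w) ≢ O → w ≡ s ⊎ w ≡ sh s ⊎ w ≡ shⁿ 2 s

  at-p : ∀ {P : Fin n → Set} → (∀ w → P (p w)) → ∀ u → P u
  at-p {P} P∘p u = subst P (p-pos u) (P∘p (pos u))

  module _ (a-nonzero : ∀ w → a w ≢ O) (framed : ∀ s → ∃ (FramedTriangle s)) where

    av : KV {n}
    av = tabulate (a ∘ pos)

    av-p : ∀ w → lookup av (p w) ≡ a w
    av-p w = trans (lookup∘tabulate (a ∘ pos) (p w)) (cong a (p-injective (p-pos (p w))))

    av-complete : Complete av
    av-complete = at-p λ w → subst (_≢ O) (sym (av-p w)) (a-nonzero w)

    t : Fin N → KV {n}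
    t s = proj₁ (framed s)

    t-IsBv : ∀ s → IsBv S av (p (sh s)) (t s)
    t-IsBv s = ∈L , trans (cong (⟨ lookup (t s) (p (sh s)) ,_⟩K) (av-p (sh s))) at-sh ,
               at-p (λ w p≢ → off w (p≢ ∘ cong p))
      where
      open FramedTriangle (proj₂ (framed s))
      off : ∀ w → w ≢ sh s → ⟨ lookup (t s) (p w) , lookup av (p w) ⟩K ≡ false
      off w w≢s₁ rewrite av-p w with lookup (t s) (p w) ≟K O
      ... | yes tw≡O = cong (⟨_, a w ⟩K) tw≡O
      ... | no  tw≢O with support w tw≢O
      ...   | inj₁ refl        = trans (cong (⟨_, a w ⟩K) at-s) (⟨⟩K-self (a w))
      ...   | inj₂ (inj₁ w≡s₁) = ⊥-elim (w≢s₁ w≡s₁)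
      ...   | inj₂ (inj₂ refl) = trans (cong (⟨_, a w ⟩K) at-sh²) (⟨⟩K-self (a w))

    av-eulerian : Eulerian S av
    av-eulerian = Bv⇒Eulerian S av av-complete (at-p λ w → t (pr w) , subst (λ v → IsBv S av (p v) (t (pr w))) (sh-pr w) (t-IsBv (pr w)))

    fundamental-adjacency : ∀ i j → i ≢ j → FundAdj S av (p i) (p j) ⇔ CycAdj ℓ i j
    fundamental-adjacency i j i≢j = mk⇔ to from
      where
      s : Fin N
      s = pr i
      bᵢ : IsBv S av (p i) (t s)
      bᵢ = subst (λ v → IsBv S av (p v) (t s)) (sh-pr i) (t-IsBv s)
      open FramedTriangle (proj₂ (framed s))
      to : FundAdj S av (p i) (p j) → CycAdj ℓ i j
      to (b , b-IsBv , bⱼ≢O) with support j (subst (_≢ O) (IsBv-unique S av-eulerian b-IsBv bᵢ (p j)) bⱼ≢O)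
      ... | inj₁ j≡s        = inj₂ (trans (sym (sh-toℕ j)) (cong toℕ (trans (cong sh j≡s) (sh-pr i))))
      ... | inj₂ (inj₁ j≡i) = ⊥-elim (i≢j (sym (trans j≡i (sh-pr i))))
      ... | inj₂ (inj₂ j≡i₁) = inj₁ (trans (sym (sh-toℕ i)) (cong toℕ (sym (trans j≡i₁ (cong sh (sh-pr i))))))
      from : CycAdj ℓ i j → FundAdj S av (p i) (p j)
      from (inj₁ i₁≡j) = t s , bᵢ , subst (λ w → lookup (t s) (p w) ≢ O) s₂≡j (subst (_≢ O) (sym at-sh²) (a-nonzero _))
        where
        s₂≡j : shⁿ 2 s ≡ j
        s₂≡j = trans (cong sh (sh-pr i)) (toℕ-injective (trans (sh-toℕ i) i₁≡j))
      from (inj₂ j₁≡i) = t s , bᵢ , subst (λ w → lookup (t s) (p w) ≢ O) s≡j (subst (_≢ O) (sym at-s) (a-nonzero s))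
        where
        s≡j : s ≡ j
        s≡j = trans (cong pr (sym (toℕ-injective (trans (sh-toℕ j) j₁≡i)))) (pr-sh j)

    fundamental-graph-is-cycle : IsCycle (FundAdj S av) ℓ
    fundamental-graph-is-cycle = p , p-injective , (λ y → pos y , λ { refl → p-pos y }) , fundamental-adjacency

-- Triangles along a tight cycle

module TriangleCycle {n : ℕ} (S : IsotropicSystem n) (3-connected : ThreeConnected S)
  (k : ℕ) (3≤k : 3 ≤ k) (p : Fin (suc (suc k)) → Fin n) (p-injective : Injective _≡_ _≡_ p) where

  open IsotropicSystem S
  open Cycle (suc k)

  p-≢ : ∀ {i j} → i ≢ j → p i ≢ p j
  p-≢ i≢j = i≢j ∘ p-injective

  sh¹≢ : ∀ s → shⁿ 1 s ≢ s
  sh¹≢ s = shⁿ-≢ 1 s (s≤s z≤n) (s≤s z≤n)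

  sh²≢ : ∀ s → shⁿ 2 s ≢ s
  sh²≢ s = shⁿ-≢ 2 s (s≤s z≤n) (s≤s (≤-trans (s≤s z≤n) 3≤k))

  sh³≢ : ∀ s → shⁿ 3 s ≢ s
  sh³≢ s = shⁿ-≢ 3 s (s≤s z≤n) (s≤s (≤-trans (s≤s (s≤s z≤n)) 3≤k))

  sh⁴≢ : ∀ s → shⁿ 4 s ≢ s
  sh⁴≢ s = shⁿ-≢ 4 s (s≤s z≤n) (s≤s 3≤k)

  TriangleAt : Fin N → KV {n} → Set
  TriangleAt s t = L t × ExactSupport t (p s) (p (sh s)) (p (shⁿ 2 s))

  module Triangle {s t} (triangle : TriangleAt s t) where
    open ExactSupport {t = t} (proj₂ triangle) public

    vanishes-at : ∀ w → w ≢ s → w ≢ sh s → w ≢ shⁿ 2 s → lookup t (p w) ≡ O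
    vanishes-at w w≢s w≢s₁ w≢s₂ = vanishes (p w) (p-≢ w≢s) (p-≢ w≢s₁) (p-≢ w≢s₂)

    vanishes-at-sh³ : lookup t (p (shⁿ 3 s)) ≡ O
    vanishes-at-sh³ = vanishes-at (shⁿ 3 s) (sh³≢ s) (sh²≢ (sh s)) (sh¹≢ (shⁿ 2 s))

    vanishes-at-sh⁴ : lookup t (p (shⁿ 4 s)) ≡ O
    vanishes-at-sh⁴ = vanishes-at (shⁿ 4 s) (sh⁴≢ s) (sh³≢ (sh s)) (sh²≢ (shⁿ 2 s))

    nonzero-at⇒ : ∀ w → lookup t (p w) ≢ O → w ≡ s ⊎ w ≡ sh s ⊎ w ≡ shⁿ 2 s
    nonzero-at⇒ w tw≢O with nonzero⇒ (p w) tw≢O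
    ... | inj₁ e        = inj₁ (p-injective e)
    ... | inj₂ (inj₁ e) = inj₂ (inj₁ (p-injective e))
    ... | inj₂ (inj₂ e) = inj₂ (inj₂ (p-injective e))

    ⟨⟩-at : ∀ v → ⟨ v , t ⟩ ≡ ⟨ lookup v (p s) , lookup t (p s) ⟩K xor
        (⟨ lookup v (p (sh s)) , lookup t (p (sh s)) ⟩K xor ⟨ lookup v (p (shⁿ 2 s)) , lookup t (p (shⁿ 2 s)) ⟩K)
    ⟨⟩-at v = ⟨⟩-expand v (p-≢ (sh¹≢ s ∘ sym)) (p-≢ (sh²≢ s ∘ sym)) (p-≢ (sh¹≢ (sh s) ∘ sym))

  module _ (triangle-at : ∀ s → s ≢ last → ∃ (TriangleAt s)) where

    -- T last is a junk value: the triangle on {p last, p 0, p 1} is the one still to be found.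
    T : Fin N → KV {n}
    T s with s ≟F last
    ... | yes _      = 0V
    ... | no s≢last = proj₁ (triangle-at s s≢last)

    T-triangle : ∀ s → s ≢ last → TriangleAt s (T s)
    T-triangle s s≢last with s ≟F last
    ... | yes s≡last = ⊥-elim (s≢last s≡last)
    ... | no s≢last′ = proj₂ (triangle-at s s≢last′)

    module T {s} (s≢last : s ≢ last) = Triangle (T-triangle s s≢last)

    module Consecutive {s} (s≢last : s ≢ last) (s₁≢last : sh s ≢ last) where
      s₁ s₂ : Fin N
      s₁ = sh s
      s₂ = sh s₁
      t₀ t₁ : KV {n}
      t₀ = T s
      t₁ = T s₁
      module t₀ = T s≢last
      module t₁ = T s₁≢last
      same-pairing : ⟨ lookup t₀ (p s₁) , lookup t₁ (p s₁) ⟩K ≡ ⟨ lookup t₀ (p s₂) , lookup t₁ (p s₂) ⟩K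
      same-pairing = trans (sym (xor-identityʳ _)) (xor-middle (pair s₁) (pair s₂) false (begin
        pair s₁ xor (pair s₂ xor false)
          ≡⟨ cong (λ x → pair s₁ xor (pair s₂ xor ⟨ x , lookup t₁ (p (sh s₂)) ⟩K)) (sym t₀.vanishes-at-sh³) ⟩
        pair s₁ xor (pair s₂ xor pair (sh s₂))
          ≡⟨ sym (t₁.⟨⟩-at t₀) ⟩
        ⟨ t₀ , t₁ ⟩ ≡⟨ L-isotr t₀ t₁ (proj₁ (T-triangle s s≢last)) (proj₁ (T-triangle s₁ s₁≢last)) ⟩
        false ∎))
        where
        open ≡-Reasoning
        pair : Fin N → Bool
        pair w = ⟨ lookup t₀ (p w) , lookup t₁ (p w) ⟩K

      pairings-not-false : ⟨ lookup t₀ (p s₁) , lookup t₁ (p s₁) ⟩K ≢ false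
      pairings-not-false e₁ = no-vector-on-two-points S 3-connected z (p-≢ (sh³≢ s ∘ sym))
        (L-add t₀ t₁ (proj₁ (T-triangle s s≢last)) (proj₁ (T-triangle s₁ s₁≢last))) z≢0 z-vanishes
        (p-≢ (sh¹≢ s₁ ∘ sym)) (p-≢ (sh¹≢ s)) (p-≢ (sh²≢ s₁ ∘ sym)) (p-≢ (sh²≢ s)) (p-≢ (sh¹≢ s₂ ∘ sym))
        where
        agree₁ : lookup t₀ (p s₁) ≡ lookup t₁ (p s₁)
        agree₁ = ⟨⟩K≡false⇒≡ t₀.nonzero₁ t₁.nonzero₀ e₁
        agree₂ : lookup t₀ (p s₂) ≡ lookup t₁ (p s₂)
        agree₂ = ⟨⟩K≡false⇒≡ t₀.nonzero₂ t₁.nonzero₁ (trans (sym same-pairing) e₁)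
        z : KV {n}
        z = t₀ +V t₁
        z≢0 : z ≢ 0V
        z≢0 z≡0 = t₀.nonzero₀ (begin
          lookup t₀ (p s)                       ≡⟨ sym (+K-identityʳ _) ⟩
          lookup t₀ (p s) +K O
            ≡⟨ cong (lookup t₀ (p s) +K_) (sym (t₁.vanishes-at s (sh¹≢ s ∘ sym) (sh²≢ s ∘ sym) (sh³≢ s ∘ sym))) ⟩
          lookup t₀ (p s) +K lookup t₁ (p s)    ≡⟨ sym (lookup-+V t₀ t₁ (p s)) ⟩
          lookup z (p s)                        ≡⟨ cong (λ v → lookup v (p s)) z≡0 ⟩
          lookup 0V (p s)                       ≡⟨ lookup-0V (p s) ⟩
          O                                     ∎)
          where open ≡-Reasoning
        z-vanishes : ∀ i → i ≢ p s → i ≢ p (shⁿ 3 s) → lookup z i ≡ O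
        z-vanishes i i≢s i≢s₃ with i ≟F p s₁ | i ≟F p s₂
        ... | yes refl | _        = trans (lookup-+V t₀ t₁ i) (trans (cong (_+K lookup t₁ i) agree₁) (+K-self (lookup t₁ i)))
        ... | no _     | yes refl = trans (lookup-+V t₀ t₁ i) (trans (cong (_+K lookup t₁ i) agree₂) (+K-self (lookup t₁ i)))
        ... | no i≢s₁  | no i≢s₂  = trans (lookup-+V t₀ t₁ i)
                                      (cong₂ _+K_ (t₀.vanishes i i≢s i≢s₁ i≢s₂) (t₁.vanishes i i≢s₁ i≢s₂ i≢s₃))

      overlap-pairings : ⟨ lookup t₀ (p s₁) , lookup t₁ (p s₁) ⟩K ≡ true ×
                         ⟨ lookup t₀ (p s₂) , lookup t₁ (p s₂) ⟩K ≡ true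
      overlap-pairings with ⟨ lookup t₀ (p s₁) , lookup t₁ (p s₁) ⟩K in e₁
      ... | true  = refl , trans (sym same-pairing) e₁
      ... | false = ⊥-elim (pairings-not-false e₁)

    triangles-two-apart : ∀ s → s ≢ last → shⁿ 2 s ≢ last →
                          lookup (T s) (p (shⁿ 2 s)) ≡ lookup (T (shⁿ 2 s)) (p (shⁿ 2 s))
    triangles-two-apart s s≢last s₂≢last = ⟨⟩K≡false⇒≡ t₀.nonzero₂ t₂.nonzero₀ (begin
      pair s₂                                         ≡⟨ sym (xor-identityʳ (pair s₂)) ⟩
      pair s₂ xor false                               ≡⟨ cong₂ (λ x y → pair s₂ xor (⟨ x , lookup t₂ (p (sh s₂)) ⟩K xor ⟨ y , lookup t₂ (p (shⁿ 2 s₂)) ⟩K))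
                                                           (sym t₀.vanishes-at-sh³) (sym t₀.vanishes-at-sh⁴) ⟩
      pair s₂ xor (pair (sh s₂) xor pair (shⁿ 2 s₂))  ≡⟨ sym (t₂.⟨⟩-at t₀) ⟩
      ⟨ t₀ , t₂ ⟩                                     ≡⟨ L-isotr t₀ t₂ (proj₁ (T-triangle s s≢last)) (proj₁ (T-triangle s₂ s₂≢last)) ⟩
      false                                           ∎)
      where
      open ≡-Reasoning
      s₂ : Fin N
      s₂ = shⁿ 2 s
      t₀ t₂ : KV {n}
      t₀ = T s
      t₂ = T s₂
      module t₀ = T s≢last
      module t₂ = T s₂≢last
      pair : Fin N → Bool
      pair w = ⟨ lookup t₀ (p w) , lookup t₂ (p w) ⟩K

    -- Triangles ending at a common vertex agree there (triangles-two-apart), so a w is read off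
    -- T w, or off T (w-2) when w = last has no triangle of its own.
    a : Fin N → K
    a w = if does (w ≟F last) then lookup (T (pr (pr w))) (p w) else lookup (T w) (p w)

    a-≢last : ∀ {w} → w ≢ last → a w ≡ lookup (T w) (p w)
    a-≢last {w} w≢last = cong (if_then lookup (T (pr (pr w))) (p w) else lookup (T w) (p w)) (dec-false (w ≟F last) w≢last)

    a-last : ∀ {w} → w ≡ last → a w ≡ lookup (T (pr (pr w))) (p w)
    a-last {w} w≡last = cong (if_then lookup (T (pr (pr w))) (p w) else lookup (T w) (p w)) (dec-true (w ≟F last) w≡last)

    T-at-s : ∀ {s} → s ≢ last → lookup (T s) (p s) ≡ a s
    T-at-s s≢last = sym (a-≢last s≢last)

    T-at-sh² : ∀ {s} → s ≢ last → lookup (T s) (p (shⁿ 2 s)) ≡ a (shⁿ 2 s)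
    T-at-sh² {s} s≢last = case shⁿ 2 s ≟F last of λ where
      (no s₂≢last)  → trans (triangles-two-apart s s≢last s₂≢last) (sym (a-≢last s₂≢last))
      (yes s₂≡last) → sym (trans (a-last s₂≡last) (cong (λ v → lookup (T v) (p (shⁿ 2 s))) (pr²-sh² s)))

    T-at-sh-before-last : ∀ {s} → s ≢ last → sh s ≡ last → ⟨ lookup (T s) (p (sh s)) , a (sh s) ⟩K ≡ true
    T-at-sh-before-last {s} s≢last s₁≡last = begin
      ⟨ lookup (T s) (p (sh s)) , a (sh s) ⟩K
        ≡⟨ cong (⟨ lookup (T s) (p (sh s)) ,_⟩K) (a-last s₁≡last) ⟩
      ⟨ lookup (T s) (p (sh s)) , lookup (T (pr (pr (sh s)))) (p (sh s)) ⟩K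
        ≡⟨ cong (λ v → ⟨ lookup (T s) (p (sh s)) , lookup (T (pr v)) (p (sh s)) ⟩K) (pr-sh s) ⟩
      ⟨ lookup (T s) (p (sh s)) , lookup (T (pr s)) (p (sh s)) ⟩K
        ≡⟨ ⟨⟩K-sym _ _ ⟩
      ⟨ lookup (T (pr s)) (p (sh s)) , lookup (T s) (p (sh s)) ⟩K
        ≡⟨ subst (λ v → ⟨ lookup (T (pr s)) (p (sh v)) , lookup (T v) (p (sh v)) ⟩K ≡ true) (sh-pr s)
             (proj₂ (Consecutive.overlap-pairings r≢last (subst (_≢ last) (sym (sh-pr s)) s≢last))) ⟩
      true ∎
      where
      open ≡-Reasoning
      r≢last : pr s ≢ last
      r≢last r≡last = sh²≢ (pr s) (trans (cong sh (sh-pr s)) (trans s₁≡last (sym r≡last)))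

    T-at-sh : ∀ {s} → s ≢ last → ⟨ lookup (T s) (p (sh s)) , a (sh s) ⟩K ≡ true
    T-at-sh {s} s≢last = case sh s ≟F last of λ where
      (no s₁≢last)  → trans (cong (⟨ lookup (T s) (p (sh s)) ,_⟩K) (a-≢last s₁≢last))
                            (proj₁ (Consecutive.overlap-pairings s≢last s₁≢last))
      (yes s₁≡last) → T-at-sh-before-last s≢last s₁≡last

    a-last-nonzero : ∀ {w} → w ≡ last → a w ≢ O
    a-last-nonzero {w} w≡last = subst (_≢ O) (trans (cong (λ v → lookup (T r) (p v)) (sh²-pr² w)) (sym (a-last w≡last)))
                                  (T.nonzero₂ r≢last)
      where
      r : Fin N
      r = pr (pr w)
      r≢last : r ≢ last
      r≢last r≡last = sh²≢ r (trans (sh²-pr² w) (trans w≡last (sym r≡last)))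

    a-nonzero : ∀ w → a w ≢ O
    a-nonzero w = case w ≟F last of λ where
      (no w≢last)  → subst (_≢ O) (T-at-s w≢last) (T.nonzero₀ w≢last)
      (yes w≡last) → a-last-nonzero w≡last

    coord : KV {n} → Fin N → Bool
    coord g w = ⟨ lookup g (p w) , a w ⟩K

    coord-+V : ∀ g h w → coord (g +V h) w ≡ coord g w xor coord h w
    coord-+V g h w = trans (cong (⟨_, a w ⟩K) (lookup-+V g h (p w))) (⟨⟩K-distribʳ-+K (lookup g (p w)) (lookup h (p w)) (a w))

    Reduced : KV {n} → Set
    Reduced g = ∀ w → w ≢ zero → coord g w ≡ false

    Reduced-+V : ∀ {g h} → Reduced g → Reduced h → Reduced (g +V h)
    Reduced-+V {g} {h} g-reduced h-reduced w w≢0 =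
      trans (coord-+V g h w) (cong₂ _xor_ (g-reduced w w≢0) (h-reduced w w≢0))

    T-coord-off : ∀ {s w} → s ≢ last → w ≢ sh s → coord (T s) w ≡ false
    T-coord-off {s} {w} s≢last w≢s₁ with lookup (T s) (p w) ≟K O
    ... | yes tw≡O = cong (⟨_, a w ⟩K) tw≡O
    ... | no  tw≢O with T.nonzero-at⇒ s≢last w tw≢O
    ...   | inj₁ refl        = trans (cong (⟨_, a w ⟩K) (T-at-s s≢last)) (⟨⟩K-self (a w))
    ...   | inj₂ (inj₁ w≡s₁) = ⊥-elim (w≢s₁ w≡s₁)
    ...   | inj₂ (inj₂ refl) = trans (cong (⟨_, a w ⟩K) (T-at-sh² s≢last)) (⟨⟩K-self (a w))

    Ts : Vec (KV {n}) (suc k)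
    Ts = tabulate (T ∘ inject₁)

    Ts⊆L : All L Ts
    Ts⊆L = tabulate⁺ λ j → proj₁ (T-triangle (inject₁ j) (inject₁≢last j))

    -- Adding T j changes the a-coordinates only at p (j+1), where ⟨T j (j+1), a (j+1)⟩ = 1.
    reduce : KV {n} → KV {n}
    reduce u = u +V combo Ts (tabulate (coord u ∘ suc))

    reduce-∈L : ∀ u → L u → L (reduce u)
    reduce-∈L u u∈L = L-add _ _ u∈L (combo-closed S Ts (tabulate (coord u ∘ suc)) Ts⊆L)

    reduce-reduced : ∀ u → Reduced (reduce u)
    reduce-reduced u zero     0≢0 = ⊥-elim (0≢0 refl)
    reduce-reduced u (suc j₀) _   = begin
      coord (reduce u) w                                               ≡⟨ coord-+V u (combo Ts cs) w ⟩
      coord u w xor ⟨ lookup (combo Ts cs) (p w) , a w ⟩K              ≡⟨ cong (coord u w xor_) (⟨⟩K-combo Ts cs (p w) (a w)) ⟩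
      coord u w xor sum (λ j → lookup cs j ∧ ⟨ lookup (lookup Ts j) (p w) , a w ⟩K)
        ≡⟨ cong (coord u w xor_) (sum-cong-≗ λ j → cong₂ (λ c t → c ∧ ⟨ lookup t (p w) , a w ⟩K)
             (lookup∘tabulate (coord u ∘ suc) j) (lookup∘tabulate (T ∘ inject₁) j)) ⟩
      coord u w xor sum (λ j → coord u (suc j) ∧ coord (T (inject₁ j)) w)
        ≡⟨ cong (coord u w xor_) (sum-single _ j₀ λ j j≢j₀ →
             trans (cong (coord u (suc j) ∧_) (T-coord-off {w = w} (inject₁≢last j) (w≢sh-inject₁ j j≢j₀)))
                   (∧-zeroʳ _)) ⟩
      coord u w xor (coord u w ∧ coord (T (inject₁ j₀)) w)
        ≡⟨ cong (λ c → coord u w xor (coord u w ∧ c))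
             (subst (λ v → coord (T (inject₁ j₀)) v ≡ true) (sh-inject₁ j₀) (T-at-sh (inject₁≢last j₀))) ⟩
      coord u w xor (coord u w ∧ true)                                 ≡⟨ cong (coord u w xor_) (∧-identityʳ _) ⟩
      coord u w xor coord u w                                          ≡⟨ xor-same (coord u w) ⟩
      false                                                            ∎
      where
      open ≡-Reasoning
      w : Fin N
      w = suc j₀
      cs : Vec Bool (suc k)
      cs = tabulate (coord u ∘ suc)
      w≢sh-inject₁ : ∀ j → j ≢ j₀ → w ≢ sh (inject₁ j)
      w≢sh-inject₁ j j≢j₀ w≡s₁ = j≢j₀ (sym (suc-injective (trans w≡s₁ (sh-inject₁ j))))

    reduce-InSpan : ∀ {e} (bs : Vec (KV {n}) e) u → InSpan bs (reduce u) → InSpan (Ts ++ bs) u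
    reduce-InSpan bs u (cs , combo≡reduce) = cs₀ ++ cs , (begin
      combo (Ts ++ bs) (cs₀ ++ cs)      ≡⟨ combo-++ Ts bs cs₀ cs ⟩
      combo Ts cs₀ +V combo bs cs       ≡⟨ cong (combo Ts cs₀ +V_) combo≡reduce ⟩
      combo Ts cs₀ +V reduce u          ≡⟨ +V-comm (combo Ts cs₀) (reduce u) ⟩
      (u +V combo Ts cs₀) +V combo Ts cs₀ ≡⟨ +V-cancelʳ u (combo Ts cs₀) ⟩
      u                                 ∎)
      where
      open ≡-Reasoning
      cs₀ : Vec Bool (suc k)
      cs₀ = tabulate (coord u ∘ suc)

    module ReducedShape {g} (g∈L : L g) (g-reduced : Reduced g) where

      T-pairing : ∀ {s} → s ≢ last →
                  coord g s xor coord g (shⁿ 2 s) ≡ ⟨ lookup g (p (sh s)) , lookup (T s) (p (sh s)) ⟩K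
      T-pairing {s} s≢last = xor-middle (coord g s) _ (coord g (shⁿ 2 s)) (begin
        coord g s xor (⟨ lookup g (p (sh s)) , lookup (T s) (p (sh s)) ⟩K xor coord g (shⁿ 2 s))
          ≡⟨ cong₂ (λ x y → ⟨ lookup g (p s) , x ⟩K xor (⟨ lookup g (p (sh s)) , lookup (T s) (p (sh s)) ⟩K xor ⟨ lookup g (p (shⁿ 2 s)) , y ⟩K))
               (sym (T-at-s s≢last)) (sym (T-at-sh² s≢last)) ⟩
        _ ≡⟨ sym (T.⟨⟩-at s≢last g) ⟩
        ⟨ g , T s ⟩ ≡⟨ L-isotr g (T s) g∈L (proj₁ (T-triangle s s≢last)) ⟩
        false ∎)
        where open ≡-Reasoning

      at-sh : ∀ {s} → s ≢ last → lookup g (p (sh s)) ≡ (if coord g s xor coord g (shⁿ 2 s) then a (sh s) else O)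
      at-sh {s} s≢last with ⟨⟩K≡false⇒O⊎≡ (lookup g (p (sh s))) (a (sh s)) (a-nonzero (sh s)) (g-reduced (sh s) (sh≢zero s≢last))
      ... | inj₁ g₁≡O  = trans g₁≡O (cong (if_then a (sh s) else O)
                           (sym (trans (T-pairing s≢last) (cong (⟨_, lookup (T s) (p (sh s)) ⟩K) g₁≡O))))
      ... | inj₂ g₁≡a₁ = trans g₁≡a₁ (cong (if_then a (sh s) else O) (sym (begin
        coord g s xor coord g (shⁿ 2 s)                       ≡⟨ T-pairing s≢last ⟩
        ⟨ lookup g (p (sh s)) , lookup (T s) (p (sh s)) ⟩K    ≡⟨ cong (⟨_, lookup (T s) (p (sh s)) ⟩K) g₁≡a₁ ⟩
        ⟨ a (sh s) , lookup (T s) (p (sh s)) ⟩K               ≡⟨ ⟨⟩K-sym _ _ ⟩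
        ⟨ lookup (T s) (p (sh s)) , a (sh s) ⟩K               ≡⟨ T-at-sh s≢last ⟩
        true                                                  ∎)))
        where open ≡-Reasoning

      at : ∀ {c} → c ≢ zero → lookup g (p c) ≡ (if coord g (pr c) xor coord g (sh c) then a c else O)
      at {c} c≢0 = subst (λ v → lookup g (p v) ≡ (if coord g (pr c) xor coord g (sh v) then a v else O))
                     (sh-pr c) (at-sh (pr≢last c≢0))

      vanishes : ∀ {c} → c ≢ zero → coord g (pr c) ≡ false → coord g (sh c) ≡ false → lookup g (p c) ≡ O
      vanishes c≢0 before after = trans (at c≢0) (cong (if_then _ else O) (cong₂ _xor_ before after))

      coord₀-false⇒vanishes : coord g zero ≡ false → ∀ c → c ≢ zero → lookup g (p c) ≡ O
      coord₀-false⇒vanishes coord₀≡false c c≢0 = vanishes c≢0 (all-false (pr c)) (all-false (sh c))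
        where
        all-false : ∀ w → coord g w ≡ false
        all-false w with w ≟F zero
        ... | yes refl = coord₀≡false
        ... | no w≢0   = g-reduced w w≢0

      module coord₀-true (coord₀≡true : coord g zero ≡ true) where

        at-sh-zero : lookup g (p (sh zero)) ≡ a (sh zero)
        at-sh-zero = trans (at (sh¹≢ zero)) (cong (if_then a (sh zero) else O) (cong₂ _xor_
          (trans (cong (coord g) (pr-sh zero)) coord₀≡true) (g-reduced (shⁿ 2 zero) (sh²≢ zero))))

        at-last : lookup g (p last) ≡ a last
        at-last = trans (at last≢0) (cong (if_then a last else O) (cong₂ _xor_
          (g-reduced (pr last) pr-last≢0) (trans (cong (coord g) sh-last) coord₀≡true)))
          where
          last≢0 : last ≢ zero
          last≢0 last≡0 = sh¹≢ zero (trans (cong sh (sym last≡0)) sh-last)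
          pr-last≢0 : pr last ≢ zero
          pr-last≢0 pr-last≡0 = sh²≢ zero (trans (cong (sh ∘ sh) (sym pr-last≡0)) (trans (cong sh (sh-pr last)) sh-last))

      support : ∀ w → lookup g (p w) ≢ O → w ≡ last ⊎ w ≡ sh last ⊎ w ≡ shⁿ 2 last
      support w gw≢O with w ≟F last | w ≟F zero | w ≟F sh zero
      ... | yes w≡last | _        | _          = inj₁ w≡last
      ... | no _       | yes w≡0  | _          = inj₂ (inj₁ (trans w≡0 (sym sh-last)))
      ... | no _       | no _     | yes w≡sh0  = inj₂ (inj₂ (trans w≡sh0 (cong sh (sym sh-last))))
      ... | no w≢last  | no w≢0   | no w≢sh0   = ⊥-elim (gw≢O (vanishes w≢0
              (g-reduced (pr w) (λ pr-w≡0 → w≢sh0 (trans (sym (sh-pr w)) (cong sh pr-w≡0))))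
              (g-reduced (sh w) (λ sh-w≡0 → w≢last (trans (sym (pr-sh w)) (trans (cong pr sh-w≡0) pr-zero))))))

    inner? : ∀ u → Dec (∃ λ j → u ≡ p (suc j))
    inner? u = any? λ j → u ≟F p (suc j)

    -- V without the inner path vertices p 1, …, p (k+1).  Reduced vectors of L whose a-coordinate
    -- at p 0 vanishes lie in L ∩ X (coord₀-false⇒vanishes), which makes c_S(X) small.
    X : Subset n
    X = tabulate (not ∘ does ∘ inner?)

    ∈X : ∀ {u} → (∀ j → u ≢ p (suc j)) → u ∈ₛ X
    ∈X {u} u-outside = lookup⇒[]= u X (trans (lookup∘tabulate (not ∘ does ∘ inner?) u)
                                              (cong not (dec-false (inner? u) λ (j , u≡) → u-outside j u≡)))

    ∉X : ∀ j → p (suc j) ∉ₛ X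
    ∉X j p∈X = case trans (sym ([]=⇒lookup p∈X)) (trans (lookup∘tabulate (not ∘ does ∘ inner?) (p (suc j)))
                            (cong not (dec-true (inner? (p (suc j))) (j , refl)))) of λ ()

    p₀∈X : p zero ∈ₛ X
    p₀∈X = ∈X λ j → p-≢ λ ()

    1+k≤∣∁X∣ : suc k ≤ ∣ ∁ X ∣
    1+k≤∣∁X∣ = injective-into⇒≤∣∣ (p ∘ suc) (suc-injective ∘ p-injective) (∁ X) (x∉p⇒x∈∁p ∘ ∉X)

    reduced-∈LIn : ∀ {g} → L g → Reduced g → coord g zero ≡ false → LIn S X g
    reduced-∈LIn {g} g∈L g-reduced coord₀≡false = g∈L , supp
      where
      supp : SuppIn g X
      supp u gᵤ≢O = ∈X λ j u≡ → gᵤ≢O (trans (cong (lookup g) u≡)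
        (ReducedShape.coord₀-false⇒vanishes g∈L g-reduced coord₀≡false (suc j) λ ()))

    dX : ℕ
    dX = proj₁ (LIn-dimension S X)

    X-dim : HasDim (LIn S X) dX
    X-dim = proj₂ (LIn-dimension S X)

    X-basis : Vec (KV {n}) dX
    X-basis = proj₁ X-dim

    X-spans : ∀ u → LIn S X u → InSpan X-basis u
    X-spans = proj₂ (proj₂ (proj₂ X-dim))

    L-basis : Vec (KV {n}) n
    L-basis = proj₁ L-dim

    L-basis⊆L : All L L-basis
    L-basis⊆L = proj₁ (proj₂ L-dim)

    L-basis-independent : Independent L-basis
    L-basis-independent = proj₁ (proj₂ (proj₂ L-dim))

    connectivity-bound : ∀ {e} (gs : Vec (KV {n}) e) →
      (∀ i → InSpan (X-basis ++ gs) (reduce (lookup L-basis i))) → ∣ X ∣ ∸ dX ≤ e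
    connectivity-bound {e} gs spans = m≤n+o⇒m∸n≤o ∣ X ∣ dX (+-cancelˡ-≤ (suc k) ∣ X ∣ (dX + e) (begin
      suc k + ∣ X ∣            ≤⟨ +-monoˡ-≤ ∣ X ∣ (subst (suc k ≤_) (∣∁p∣≡n∸∣p∣ X) 1+k≤∣∁X∣) ⟩
      (n ∸ ∣ X ∣) + ∣ X ∣      ≡⟨ m∸n+n≡m (∣p∣≤n X) ⟩
      n                        ≤⟨ independent-in-span⇒≤ L-basis (Ts ++ (X-basis ++ gs)) L-basis-independent
                                    (λ i → reduce-InSpan (X-basis ++ gs) _ (spans i)) ⟩
      suc k + (dX + e)         ∎))
      where open ≤-Reasoning

    reduced-with-coord₀ : ∃ λ g → L g × Reduced g × coord g zero ≡ true
    reduced-with-coord₀ with any? (λ i → coord (reduce (lookup L-basis i)) zero ≟B true)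
    ... | yes (i , coord₀≡true) =
      reduce (lookup L-basis i) , reduce-∈L _ (lookup⁺ L-basis⊆L i) , reduce-reduced (lookup L-basis i) , coord₀≡true
    ... | no ∄i = ⊥-elim (proj₁ (3-connected X)
                    (∈⇒1≤∣∣ p₀∈X , ≤-trans (s≤s z≤n) 1+k≤∣∁X∣ , dX , X-dim , s≤s (connectivity-bound [] spans)))
      where
      spans : ∀ i → InSpan (X-basis ++ []) (reduce (lookup L-basis i))
      spans i = InSpan-++⁺ˡ X-basis [] (X-spans _ (reduced-∈LIn (reduce-∈L b (lookup⁺ L-basis⊆L i)) (reduce-reduced b)
                  (¬-not λ coord₀≡true → ∄i (i , coord₀≡true))))
        where
        b : KV {n}
        b = lookup L-basis i

    g : KV {n}
    g = proj₁ reduced-with-coord₀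

    g∈L : L g
    g∈L = proj₁ (proj₂ reduced-with-coord₀)

    g-reduced : Reduced g
    g-reduced = proj₁ (proj₂ (proj₂ reduced-with-coord₀))

    g-coord₀ : coord g zero ≡ true
    g-coord₀ = proj₂ (proj₂ (proj₂ reduced-with-coord₀))

    reduce-spanned-with-g : ∀ {u} → L u → InSpan (X-basis ++ g ∷ []) (reduce u)
    reduce-spanned-with-g {u} u∈L with coord (reduce u) zero in coord₀
    ... | false = InSpan-++⁺ˡ X-basis (g ∷ []) (X-spans (reduce u) (reduced-∈LIn (reduce-∈L u u∈L) (reduce-reduced u) coord₀))
    ... | true  = InSpan-+V-∷ʳ X-basis g (X-spans (reduce u +V g)
                    (reduced-∈LIn (L-add _ _ (reduce-∈L u u∈L) g∈L) (Reduced-+V {reduce u} {g} (reduce-reduced u) g-reduced)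
                                  (trans (coord-+V (reduce u) g zero) (cong₂ _xor_ coord₀ g-coord₀))))

    p-onto : ∀ y → ∃ λ w → p w ≡ y
    p-onto y with any? (λ w → p w ≟F y)
    ... | yes found = found
    ... | no ∄w = ⊥-elim (proj₂ (3-connected X)
                    (distinct∈⇒2≤∣∣ X (λ y≡p₀ → ∄w (zero , sym y≡p₀)) y∈X p₀∈X , ≤-trans (s≤s (≤-trans (s≤s z≤n) 3≤k)) 1+k≤∣∁X∣ ,
                     dX , X-dim , s≤s (connectivity-bound (g ∷ []) (reduce-spanned-with-g ∘ lookup⁺ L-basis⊆L))))
      where
      y∈X : y ∈ₛ X
      y∈X = ∈X λ j y≡ → ∄w (suc j , sym y≡)

    open FundamentalCycle S (suc k) p p-injective (proj₁ ∘ p-onto) (proj₂ ∘ p-onto) a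

    T-framed : ∀ {s} → s ≢ last → FramedTriangle s (T s)
    T-framed s≢last = record
      { ∈L      = proj₁ (T-triangle _ s≢last)
      ; at-s    = T-at-s s≢last
      ; at-sh   = T-at-sh s≢last
      ; at-sh²  = T-at-sh² s≢last
      ; support = T.nonzero-at⇒ s≢last
      }

    g-framed : FramedTriangle last g
    g-framed = record
      { ∈L      = g∈L
      ; at-s    = at-last
      ; at-sh   = subst (λ v → coord g v ≡ true) (sym sh-last) g-coord₀
      ; at-sh²  = subst (λ v → lookup g (p (sh v)) ≡ a (sh v)) (sym sh-last) at-sh-zero
      ; support = support
      }
      where open ReducedShape g∈L g-reduced
            open ReducedShape.coord₀-true g∈L g-reduced g-coord₀

    framed : ∀ s → ∃ (FramedTriangle s)
    framed s = case s ≟F last of λ where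
      (no s≢last)  → T s , T-framed s≢last
      (yes s≡last) → subst (∃ ∘ FramedTriangle) (sym s≡last) (g , g-framed)

    eulerian-cycle : ∃ λ a → Eulerian S a × IsCycle (FundAdj S a) (suc k)
    eulerian-cycle = av a-nonzero framed , av-eulerian a-nonzero framed , fundamental-graph-is-cycle a-nonzero framed

module _ {n : ℕ} (S : IsotropicSystem n) (k : ℕ) (p : Fin (suc (suc k)) → Fin n) where
  open Cycle (suc k)

  tight-cycle-edges :
    (∀ (i : Fin k) → HEdge S (p (inject₁ (inject₁ i))) (p (suc (inject₁ i))) (p (suc (suc i)))) →
    HEdge S (p (inject₁ (fromℕ k))) (p (fromℕ (suc k))) (p zero) →
    ∀ s → s ≢ last → HEdge S (p s) (p (sh s)) (p (shⁿ 2 s))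
  tight-cycle-edges inner closing s s≢last with view s
  ... | ‵fromℕ = ⊥-elim (s≢last refl)
  ... | ‵inj₁ ‵fromℕ rewrite sh-inject₁ (fromℕ k) | sh-last = closing
  ... | ‵inj₁ (‵inj₁ {i = i} _) rewrite sh-inject₁ (inject₁ i) | sh-inject₁ (suc i) = inner i

lemma4p11 : ∀ {n : ℕ} (S : IsotropicSystem n) → ThreeConnected S
    → (k : ℕ) → 3 ≤ k
    → (p : Fin (suc (suc k)) → Fin n) → Injective _≡_ _≡_ p
    → (∀ (i : Fin k) → HEdge S (p (inject₁ (inject₁ i))) (p (suc (inject₁ i))) (p (suc (suc i))))
    → HEdge S (p (inject₁ (fromℕ k))) (p (fromℕ (suc k))) (p zero)
    → ∃ λ a → Eulerian S a × IsCycle (FundAdj S a) (suc k)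
lemma4p11 S 3-connected k 3≤k p p-injective inner closing =
  TriangleCycle.eulerian-cycle S 3-connected k 3≤k p p-injective
    λ s s≢last → proj₂ (proj₂ (proj₂ (tight-cycle-edges S k p inner closing s s≢last)))
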